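{- For $n\ge2$ and $1\le i<j\le n$ let $r_{n,i,j}=\sum_\pi y^{\mu(\pi)}$, the sum over all $\pi\in\mathcal{D}_{3\text{ - }21}(n)$ whose last cycle (in standard cycle form) starts with $i$ and ends with $j$, and let $s_{n,i,j}$ be the same sum restricted to those $\pi$ whose last cycle has length at least three. Then for $n\ge3$ and $1\le i<j\le n$, $$r_{n,i,j}=[j<n]\,r_{n-1,i,n-1}+\sum_{k=i+1}^{j-1}r_{n-1,i,k}+y\sum_{\ell=1}^{i-1}s_{n-1,\ell,i},$$ $$s_{n,i,j}=r_{n,i,j}-y\sum_{\ell=1}^{i-1}s_{n-1,\ell,i},$$ with $r_{2,1,2}=y$ and $s_{2,1,2}=0$. Here $[S]$ is $1$ if the statement $S$ is true and $0$ otherwise.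
   Context: Every permutation $\pi$ of $[n]=\{1,\dots,n\}$ is written in standard cycle form: each cycle is written starting with its smallest element, and the cycles are ordered from left to right by increasing first elements. The flattened form $\mathrm{flat}(\pi)$ is the word (in one-line notation) obtained by erasing the parentheses of the standard cycle form. A derangement is a permutation with no fixed points; $\mathcal{D}(n)$ is the set of derangements of $[n]$, and $\mu(\pi)$ denotes the number of cycles of $\pi$. A word $w=w_1\cdots w_n$ of distinct integers contains the vincular pattern $3\text{ - }21$ if there are indices $i<j$ with $j+1\le n$ and $w_{j+1}<w_j<w_i$, and avoids it otherwise. $\mathcal{D}_{3\text{ - }21}(n)$ is the set of $\pi\in\mathcal{D}(n)$ such that $\mathrm{flat}(\pi)$ avoids $3\text{ - }21$. -}

module Defs where

-- A permutation of [n] is given in one-line notation as a list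
-- π(1) π(2) … π(n) of natural numbers; the permutations of [n] are
-- enumerated (each exactly once) by `permutations n`.

open import Data.Bool using (Bool; true; false; _∧_; _∨_; not; if_then_else_)
open import Data.Nat using (ℕ; zero; suc; _+_; _*_; _∸_; _^_; _≡ᵇ_; _<ᵇ_; _≤ᵇ_)
open import Data.List using (List; []; _∷_; map; concatMap; concat; length; filterᵇ; applyUpTo; _++_)
open import Data.Nat.ListAction using (sum)
open import Data.Bool.ListAction using (any; all)
open import Data.Maybe using (Maybe; just; nothing)

insertAll : ℕ → List ℕ → List (List ℕ)
insertAll x []       = (x ∷ []) ∷ []
insertAll x (y ∷ ys) = (x ∷ y ∷ ys) ∷ map (y ∷_) (insertAll x ys)

perms : List ℕ → List (List ℕ)
perms []       = [] ∷ []
perms (x ∷ xs) = concatMap (insertAll x) (perms xs)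

[1‥_] : ℕ → List ℕ
[1‥ n ] = applyUpTo suc n

permutations : ℕ → List (List ℕ)
permutations n = perms [1‥ n ]

-- the list a , a+1 , … , b-1   (empty if b ≤ a)
range : ℕ → ℕ → List ℕ
range a b = applyUpTo (a +_) (b ∸ a)

app : List ℕ → ℕ → ℕ
app []       _             = 0
app (x ∷ xs) zero          = 0
app (x ∷ xs) (suc zero)    = x
app (x ∷ xs) (suc (suc k)) = app xs (suc k)

-- the cycle of π through `start`, written start, π(start), π²(start), …
-- (fuel bounds the length; fuel = n suffices for permutations of [n])
cycleFrom : List ℕ → ℕ → ℕ → ℕ → List ℕ
cycleFrom π zero       start cur = []
cycleFrom π (suc fuel) start cur with app π cur ≡ᵇ start
... | true  = cur ∷ []
... | false = cur ∷ cycleFrom π fuel start (app π cur)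

_∈ᵇ_ : ℕ → List ℕ → Bool
x ∈ᵇ xs = any (x ≡ᵇ_) xs

-- scan candidates in increasing order; an element not yet seen is the
-- smallest element of its cycle, which is then written starting from it.
cyclesAux : List ℕ → ℕ → List ℕ → List ℕ → List (List ℕ)
cyclesAux π n seen []       = []
cyclesAux π n seen (k ∷ ks) with k ∈ᵇ seen
... | true  = cyclesAux π n seen ks
... | false = let c = cycleFrom π n k k in c ∷ cyclesAux π n (seen ++ c) ks

-- standard cycle form of a permutation π of [n]: each cycle starts with its
-- smallest element, cycles ordered by increasing first elements
cycleForm : ℕ → List ℕ → List (List ℕ)
cycleForm n π = cyclesAux π n [] [1‥ n ]

flat : ℕ → List ℕ → List ℕ
flat n π = concat (cycleForm n π)

μ : ℕ → List ℕ → ℕ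
μ n π = length (cycleForm n π)

isDerangement : ℕ → List ℕ → Bool
isDerangement n π = all (λ k → not (app π k ≡ᵇ k)) [1‥ n ]

adjBelow : ℕ → List ℕ → Bool
adjBelow x []           = false
adjBelow x (a ∷ [])     = false
adjBelow x (a ∷ b ∷ ws) = ((b <ᵇ a) ∧ (a <ᵇ x)) ∨ adjBelow x (b ∷ ws)

-- w contains the vincular pattern 3-21: i < j, w_{j+1} < w_j < w_i
contains3-21 : List ℕ → Bool
contains3-21 []       = false
contains3-21 (x ∷ ws) = adjBelow x ws ∨ contains3-21 ws

inD3-21 : ℕ → List ℕ → Bool
inD3-21 n π = isDerangement n π ∧ not (contains3-21 (flat n π))

lastOf : List (List ℕ) → List ℕ
lastOf []           = []
lastOf (c ∷ [])     = c
lastOf (c ∷ d ∷ cs) = lastOf (d ∷ cs)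

firstIs : ℕ → List ℕ → Bool
firstIs i []      = false
firstIs i (x ∷ _) = i ≡ᵇ x

lastIs : ℕ → List ℕ → Bool
lastIs j []           = false
lastIs j (x ∷ [])     = j ≡ᵇ x
lastIs j (x ∷ y ∷ xs) = lastIs j (y ∷ xs)

lastCycleIJ : ℕ → ℕ → ℕ → List ℕ → Bool
lastCycleIJ n i j π = firstIs i (lastOf (cycleForm n π)) ∧ lastIs j (lastOf (cycleForm n π))

lastCycleLong : ℕ → List ℕ → Bool
lastCycleLong n π = 3 ≤ᵇ length (lastOf (cycleForm n π))

r : ℕ → ℕ → ℕ → ℕ → ℕ
r n i j y = sum (map (λ π → y ^ μ n π)
  (filterᵇ (λ π → inD3-21 n π ∧ lastCycleIJ n i j π) (permutations n)))

s : ℕ → ℕ → ℕ → ℕ → ℕ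
s n i j y = sum (map (λ π → y ^ μ n π)
  (filterᵇ (λ π → inD3-21 n π ∧ lastCycleIJ n i j π ∧ lastCycleLong n π) (permutations n)))

ind< : ℕ → ℕ → ℕ
ind< a b = if a <ᵇ b then 1 else 0

{-# OPTIONS --safe #-}
-- r and s are sums over permutations; we turn them into sums over standard cycle forms. The cycle
-- forms of [n] are enumerated without repetition by inserting n into those of [n-1], either as a new
-- cycle (n) or right after some entry a. Reading off successors maps this list onto `permutations n`:
-- `cycleForm` inverts the map and both lists have n! entries, so it is a bijection.
-- Let the last cycle of a form counted by r_{n,i,j} be (i … k j).
-- If it has at least three entries, deleting j and closing the gap at j gives a form whose last cycle
-- ends with k when k < j; when k > j, avoiding 3-21 forces k = n, which becomes n - 1 and requires j < n.
-- This is a bijection onto the forms counted by the right-hand side for s_{n,i,j}.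
-- If the last cycle is (i j), deleting j and appending i to the previous cycle (ℓ …) is a bijection onto
-- the forms counted by s_{n-1,ℓ,i} with ℓ < i, with one cycle fewer; this is the term y Σ s_{n-1,ℓ,i}.

module Submission where

open import Data.Bool using (Bool; true; false; if_then_else_; T; T?; not; _∧_; _∨_)
open import Data.Bool.ListAction using (any; all; and)
open import Data.Bool.Properties
  using ( T-≡; not-injective; if-float; ∧-assoc; ∧-identityʳ; ∧-zeroʳ; ∨-assoc; ∨-identityʳ; ∨-zeroʳ
        ; ∧-conicalˡ; ∧-conicalʳ; ∨-conicalˡ; ∨-conicalʳ; ∧-distribˡ-∨; ∧-distribʳ-∨ )
open import Data.Bool.Solver using (module ∨-∧-Solver)
open import Data.Empty using (⊥; ⊥-elim)
open import Data.List
  using (List; []; _∷_; _++_; [_]; _∷ʳ_; map; filterᵇ; length; concat; concatMap; applyUpTo; null; initLast; _∷ʳ′_)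
open import Data.List.Membership.Propositional using (_∈_; _∉_; find)
open import Data.List.Membership.Propositional.Properties
  using ( ∈-∃++; ∈-++⁺ˡ; ∈-++⁺ʳ; ∈-++⁻; ∈-map⁺; ∈-map⁻; ∈-filter⁺; ∈-filter⁻; ∈-concat⁺′; ∈-concat⁻′
        ; ∈-applyUpTo⁺; ∈-applyUpTo⁻ )
open import Data.List.Properties
  using ( ++-identityʳ; ++-assoc; length-++; length-map; length-applyUpTo; concat-++; map-++; map-∘
        ; map-cong; map-cong-local; map-id-local; map-applyUpTo; filter-all; ∷-injective )
open import Data.List.Relation.Binary.Permutation.Propositional
  using (_↭_; ↭-refl; ↭-sym; ↭-trans; ↭-prep; module PermutationReasoning)
open import Data.List.Relation.Binary.Permutation.Propositional.Properties
  using (shift; drop-mid; ↭-length; ++⁺; ∷↭∷ʳ; ∈-resp-↭) renaming (map⁺ to ↭-map⁺)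
open import Data.List.Relation.Binary.Subset.Propositional using (_⊆_)
open import Data.List.Relation.Unary.All as All using (All; []; _∷_)
import Data.List.Relation.Unary.All.Properties as All
open import Data.List.Relation.Unary.AllPairs using (AllPairs; []; _∷_)
import Data.List.Relation.Unary.AllPairs.Properties as AllPairs
open import Data.List.Relation.Unary.Any as Any using (here; there)
import Data.List.Relation.Unary.Any.Properties as Any
open import Data.List.Relation.Unary.Unique.Propositional using (Unique)
import Data.List.Relation.Unary.Unique.Propositional.Properties as Unique
open import Data.List.Relation.Unary.Unique.Propositional.Properties using (Unique[x∷xs]⇒x∉xs)
open import Data.Nat using (ℕ; zero; suc; pred; _+_; _*_; _∸_; _^_; _!; _≤_; _<_; z≤n; s≤s; z<s; _≡ᵇ_; _<ᵇ_; _≤ᵇ_)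
open import Data.Nat.ListAction using (sum)
open import Data.Nat.ListAction.Properties using (sum-↭)
open import Data.Nat.Properties
open import Algebra.Properties.CommutativeSemigroup +-commutativeSemigroup using (interchange)
open import Data.Product using (∃; ∃₂; _×_; _,_; proj₁; proj₂)
open import Data.Sum using (_⊎_; inj₁; inj₂; [_,_]′; map₁; map₂)
open import Function using (_∘_; id; Equivalence)
open import Relation.Binary.Definitions using (tri<; tri≈; tri>)
open import Relation.Binary.PropositionalEquality
  using (_≡_; _≢_; refl; sym; trans; cong; cong₂; subst; subst₂; module ≡-Reasoning)
open import Relation.Nullary using (¬_; yes; no)

open import Defs

module _ {A : Set} where

  Unique-++⁻ˡ : (xs : List A) {ys : List A} → Unique (xs ++ ys) → Unique xs
  Unique-++⁻ˡ []       _          = []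
  Unique-++⁻ˡ (x ∷ xs) (x∉ ∷ xs!) = All.++⁻ˡ xs x∉ ∷ Unique-++⁻ˡ xs xs!

  Unique-++⁻ʳ : (xs : List A) {ys : List A} → Unique (xs ++ ys) → Unique ys
  Unique-++⁻ʳ []       ys!       = ys!
  Unique-++⁻ʳ (x ∷ xs) (_ ∷ xs!) = Unique-++⁻ʳ xs xs!

  Unique-++⇒disjoint : (xs : List A) {ys : List A} {z : A} → Unique (xs ++ ys) → z ∈ xs → z ∉ ys
  Unique-++⇒disjoint (x ∷ xs) (x∉ ∷ _)   (here refl) z∈ys = All.lookup (All.++⁻ʳ xs x∉) z∈ys refl
  Unique-++⇒disjoint (x ∷ xs) (_ ∷ xs!) (there z∈xs) z∈ys = Unique-++⇒disjoint xs xs! z∈xs z∈ys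

  Unique-concat⁻ : {xss : List (List A)} {xs : List A} → Unique (concat xss) → xs ∈ xss → Unique xs
  Unique-concat⁻ {xs ∷ _}   xss! (here refl) = Unique-++⁻ˡ xs xss!
  Unique-concat⁻ {ys ∷ xss} xss! (there xs∈) = Unique-concat⁻ (Unique-++⁻ʳ ys xss!) xs∈

  Unique-∷ʳ⇒∉ : {xs : List A} {x : A} → Unique (xs ++ [ x ]) → x ∉ xs
  Unique-∷ʳ⇒∉ {xs} xs∷ʳx! x∈xs = Unique-++⇒disjoint xs xs∷ʳx! x∈xs (here refl)

  Unique-∷⁺ : {x : A} {xs : List A} → x ∉ xs → Unique xs → Unique (x ∷ xs)
  Unique-∷⁺ x∉ xs! = All.¬Any⇒All¬ _ x∉ ∷ xs!

  Unique-++⁺ : {xs ys : List A} → Unique xs → Unique ys → (∀ {z} → z ∈ xs → z ∉ ys) → Unique (xs ++ ys)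
  Unique-++⁺ xs! ys! disj = Unique.++⁺ xs! ys! (λ (z∈xs , z∈ys) → disj z∈xs z∈ys)

  Unique-filterᵇ⁺ : (p : A → Bool) {xs : List A} → Unique xs → Unique (filterᵇ p xs)
  Unique-filterᵇ⁺ p = Unique.filter⁺ (T? ∘ p)

module _ {A B : Set} where

  Unique-map⁺ : (f : A → B) {xs : List A} → (∀ {x y} → x ∈ xs → y ∈ xs → f x ≡ f y → x ≡ y) →
                Unique xs → Unique (map f xs)
  Unique-map⁺ f {[]}     _   []         = []
  Unique-map⁺ f {x ∷ xs} inj (x∉ ∷ xs!) =
    All.map⁺ (All.tabulate λ y∈ fx≡fy → All.lookup x∉ y∈ (inj (here refl) (there y∈) fx≡fy))
    ∷ Unique-map⁺ f (λ x∈ y∈ → inj (there x∈) (there y∈)) xs!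

  Unique-concatMap⁺ : (g : A → List B) {xs : List A} → Unique xs → (∀ {x} → x ∈ xs → Unique (g x)) →
    (∀ {x y z} → x ∈ xs → y ∈ xs → z ∈ g x → z ∈ g y → x ≡ y) → Unique (concatMap g xs)
  Unique-concatMap⁺ g {[]}     []         _  _    = []
  Unique-concatMap⁺ g {x ∷ xs} (x∉ ∷ xs!) g! disj =
    Unique-++⁺ (g! (here refl))
      (Unique-concatMap⁺ g xs! (g! ∘ there) (λ x∈ y∈ → disj (there x∈) (there y∈)))
      λ z∈gx z∈rest → apart z∈gx (∈-concat⁻′ (map g xs) z∈rest)
    where
    apart : ∀ {z} → z ∈ g x → (∃ λ ys → z ∈ ys × ys ∈ map g xs) → ⊥
    apart z∈gx (ys , z∈ys , ys∈) with y , y∈xs , refl ← ∈-map⁻ g ys∈ =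
      All.lookup x∉ y∈xs (disj (here refl) (there y∈xs) z∈gx z∈ys)

module _ {A : Set} where

  ⊆⇒↭-++ : {xs ys : List A} → Unique xs → xs ⊆ ys → ∃ λ zs → ys ↭ xs ++ zs
  ⊆⇒↭-++ {[]}     {ys} _          _     = ys , ↭-refl
  ⊆⇒↭-++ {x ∷ xs} {ys} (x∉ ∷ xs!) xs⊆ys with ∈-∃++ (xs⊆ys (here refl))
  ... | as , bs , refl
    with ⊆⇒↭-++ xs! (λ {y} y∈xs → ∈-remove as bs (xs⊆ys (there y∈xs)) (All.lookup x∉ y∈xs ∘ sym))
    where
    ∈-remove : ∀ {y} as bs → y ∈ as ++ x ∷ bs → y ≢ x → y ∈ as ++ bs
    ∈-remove []       bs (here refl)  y≢x = ⊥-elim (y≢x refl)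
    ∈-remove []       bs (there y∈)   _   = y∈
    ∈-remove (a ∷ as) bs (here refl)  _   = here refl
    ∈-remove (a ∷ as) bs (there y∈)   y≢x = there (∈-remove as bs y∈ y≢x)
  ... | zs , ys↭ = zs , ↭-trans (shift x as bs) (↭-prep x ys↭)

  Unique-⊆⇒length≤ : {xs ys : List A} → Unique xs → xs ⊆ ys → length xs ≤ length ys
  Unique-⊆⇒length≤ {xs} xs! xs⊆ys with zs , ys↭ ← ⊆⇒↭-++ xs! xs⊆ys =
    subst (length xs ≤_) (sym (trans (↭-length ys↭) (length-++ xs))) (m≤m+n (length xs) (length zs))

  Unique-⊆-length⇒↭ : {xs ys : List A} → Unique xs → xs ⊆ ys → length ys ≤ length xs → xs ↭ ys
  Unique-⊆-length⇒↭ {xs} {ys} xs! xs⊆ys ys≤xs with ⊆⇒↭-++ xs! xs⊆ys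
  ... | []     , ys↭ = ↭-sym (subst (ys ↭_) (++-identityʳ xs) ys↭)
  ... | z ∷ zs , ys↭ = ⊥-elim (<⇒≱ xs<ys ys≤xs)
    where
    xs<ys : length xs < length ys
    xs<ys = subst (length xs <_) (sym (trans (↭-length ys↭) (length-++ xs))) (m<m+n (length xs) z<s)

  Unique-⊆-⊇⇒↭ : {xs ys : List A} → Unique xs → Unique ys → xs ⊆ ys → ys ⊆ xs → xs ↭ ys
  Unique-⊆-⊇⇒↭ xs! ys! xs⊆ys ys⊆xs = Unique-⊆-length⇒↭ xs! xs⊆ys (Unique-⊆⇒length≤ ys! ys⊆xs)

≡ᵇ-refl : ∀ n → (n ≡ᵇ n) ≡ true
≡ᵇ-refl n = Equivalence.to T-≡ (≡⇒≡ᵇ n n refl)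

≡ᵇ-true⇒≡ : ∀ {m n} → (m ≡ᵇ n) ≡ true → m ≡ n
≡ᵇ-true⇒≡ {m} {n} eq = ≡ᵇ⇒≡ m n (Equivalence.from T-≡ eq)

≢⇒≡ᵇ-false : ∀ {m n} → m ≢ n → (m ≡ᵇ n) ≡ false
≢⇒≡ᵇ-false {m} {n} m≢n with m ≡ᵇ n in eq
... | true  = ⊥-elim (m≢n (≡ᵇ-true⇒≡ eq))
... | false = refl

<ᵇ-true⇒< : ∀ {m n} → (m <ᵇ n) ≡ true → m < n
<ᵇ-true⇒< {m} {n} eq = <ᵇ⇒< m n (Equivalence.from T-≡ eq)

<⇒<ᵇ-true : ∀ {m n} → m < n → (m <ᵇ n) ≡ true
<⇒<ᵇ-true m<n = Equivalence.to T-≡ (<⇒<ᵇ m<n)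

≤⇒≤ᵇ-true : ∀ {m n} → m ≤ n → (m ≤ᵇ n) ≡ true
≤⇒≤ᵇ-true m≤n = Equivalence.to T-≡ (≤⇒≤ᵇ m≤n)

≮⇒<ᵇ-false : ∀ {m n} → ¬ m < n → (m <ᵇ n) ≡ false
≮⇒<ᵇ-false {m} {n} m≮n with m <ᵇ n in eq
... | true  = ⊥-elim (m≮n (<ᵇ-true⇒< eq))
... | false = refl

∈ᵇ⇒∈ : ∀ {x} xs → (x ∈ᵇ xs) ≡ true → x ∈ xs
∈ᵇ⇒∈ {x} (y ∷ ys) eq with x ≡ᵇ y in x≡ᵇy
... | true  = here (≡ᵇ-true⇒≡ x≡ᵇy)
... | false = there (∈ᵇ⇒∈ ys eq)

∈⇒∈ᵇ : ∀ {x} xs → x ∈ xs → (x ∈ᵇ xs) ≡ true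
∈⇒∈ᵇ {x} (y ∷ ys) (here refl) rewrite ≡ᵇ-refl x = refl
∈⇒∈ᵇ {x} (y ∷ ys) (there x∈) rewrite ∈⇒∈ᵇ ys x∈ with x ≡ᵇ y
... | true  = refl
... | false = refl

∉⇒∈ᵇ-false : ∀ {x} xs → x ∉ xs → (x ∈ᵇ xs) ≡ false
∉⇒∈ᵇ-false {x} xs x∉ with x ∈ᵇ xs in eq
... | true  = ⊥-elim (x∉ (∈ᵇ⇒∈ xs eq))
... | false = refl

∧-true⁻ : ∀ {a b} → a ∧ b ≡ true → a ≡ true × b ≡ true
∧-true⁻ ab = ∧-conicalˡ _ _ ab , ∧-conicalʳ _ _ ab

∨-false⁻ : ∀ {a b} → a ∨ b ≡ false → a ≡ false × b ≡ false
∨-false⁻ ab = ∨-conicalˡ _ _ ab , ∨-conicalʳ _ _ ab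

false≢true : false ≢ true
false≢true ()

any-true⁺ : ∀ {A : Set} (p : A → Bool) {xs x} → x ∈ xs → p x ≡ true → any p xs ≡ true
any-true⁺ p x∈ px = Equivalence.to T-≡ (Any.any⁺ p (Any.map (λ { refl → Equivalence.from T-≡ px }) x∈))

any-true⁻ : ∀ {A : Set} (p : A → Bool) xs → any p xs ≡ true → ∃ λ x → x ∈ xs × p x ≡ true
any-true⁻ p xs any≡ = let (x , x∈ , px) = find (Any.any⁻ p xs (Equivalence.from T-≡ any≡))
                      in x , x∈ , Equivalence.to T-≡ px

any-false⁺ : ∀ {A : Set} (p : A → Bool) xs → (∀ {x} → x ∈ xs → p x ≡ false) → any p xs ≡ false
any-false⁺ p xs none with any p xs in eq
... | false = refl
... | true  = let (x , x∈ , px) = any-true⁻ p xs eq in ⊥-elim (false≢true (trans (sym (none x∈)) px))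

any-∧ˡ : ∀ {A : Set} a (p : A → Bool) xs → any (λ x → a ∧ p x) xs ≡ a ∧ any p xs
any-∧ˡ a p []       = sym (∧-zeroʳ a)
any-∧ˡ a p (x ∷ xs) = trans (cong ((a ∧ p x) ∨_) (any-∧ˡ a p xs)) (sym (∧-distribˡ-∨ a (p x) (any p xs)))

any-∧ʳ : ∀ {A : Set} (p : A → Bool) c xs → any (λ x → p x ∧ c) xs ≡ any p xs ∧ c
any-∧ʳ p c []       = refl
any-∧ʳ p c (x ∷ xs) = trans (cong ((p x ∧ c) ∨_) (any-∧ʳ p c xs)) (sym (∧-distribʳ-∨ c (p x) (any p xs)))

all-++ : ∀ {A : Set} (p : A → Bool) xs {ys} → all p (xs ++ ys) ≡ all p xs ∧ all p ys
all-++ p []       = refl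
all-++ p (x ∷ xs) = trans (cong (p x ∧_) (all-++ p xs)) (sym (∧-assoc (p x) _ _))

all-⊆-⊇ : ∀ {A : Set} (p : A → Bool) {xs ys} → xs ⊆ ys → ys ⊆ xs → all p xs ≡ all p ys
all-⊆-⊇ p {xs} {ys} xs⊆ys ys⊆xs with all p xs in eqx | all p ys in eqy
... | true  | true  = refl
... | false | false = refl
... | true  | false = ⊥-elim (subst T eqy (All.all-anti-mono p ys⊆xs (subst T (sym eqx) _)))
... | false | true  = ⊥-elim (subst T eqx (All.all-anti-mono p xs⊆ys (subst T (sym eqy) _)))

module _ {A : Set} where

  sum-map-cong-local : (f g : A → ℕ) {xs : List A} → (∀ {x} → x ∈ xs → f x ≡ g x) →
                       sum (map f xs) ≡ sum (map g xs)
  sum-map-cong-local f g f≗g = cong sum (map-cong-local (All.tabulate f≗g))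

  sum-map-filterᵇ : (p : A → Bool) (f : A → ℕ) (xs : List A) →
                    sum (map f (filterᵇ p xs)) ≡ sum (map (λ x → if p x then f x else 0) xs)
  sum-map-filterᵇ p f []       = refl
  sum-map-filterᵇ p f (x ∷ xs) with p x
  ... | true  = cong (f x +_) (sum-map-filterᵇ p f xs)
  ... | false = sum-map-filterᵇ p f xs

  sum-map-+ : (f g : A → ℕ) (xs : List A) → sum (map (λ x → f x + g x) xs) ≡ sum (map f xs) + sum (map g xs)
  sum-map-+ f g []       = refl
  sum-map-+ f g (x ∷ xs) = begin
    (f x + g x) + sum (map (λ x → f x + g x) xs)        ≡⟨ cong (f x + g x +_) (sum-map-+ f g xs) ⟩
    (f x + g x) + (sum (map f xs) + sum (map g xs))     ≡⟨ interchange (f x) (g x) _ _ ⟩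
    (f x + sum (map f xs)) + (g x + sum (map g xs))     ∎
    where open ≡-Reasoning

  sum-map-* : (c : ℕ) (f : A → ℕ) (xs : List A) → sum (map (λ x → c * f x) xs) ≡ c * sum (map f xs)
  sum-map-* c f []       = sym (*-zeroʳ c)
  sum-map-* c f (x ∷ xs) = trans (cong (c * f x +_) (sum-map-* c f xs)) (sym (*-distribˡ-+ c (f x) _))

module _ {A B : Set} where

  sum-map-swap : (f : A → B → ℕ) (xs : List A) (ys : List B) →
    sum (map (λ x → sum (map (f x) ys)) xs) ≡ sum (map (λ y → sum (map (λ x → f x y) xs)) ys)
  sum-map-swap f []       ys = sym (sum-map-zero ys)
    where
    sum-map-zero : (ys : List B) → sum (map (λ _ → 0) ys) ≡ 0
    sum-map-zero []       = refl
    sum-map-zero (_ ∷ ys) = sum-map-zero ys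
  sum-map-swap f (x ∷ xs) ys = trans (cong (sum (map (f x) ys) +_) (sum-map-swap f xs ys))
    (sym (sum-map-+ (f x) (λ y → sum (map (λ x → f x y) xs)) ys))

  sum-if-bijection : {xs : List A} {ys : List B} → Unique xs → Unique ys →
    (p : A → Bool) (q : B → Bool) (f : A → ℕ) (g : B → ℕ) (ψ : A → B) (φ : B → A) →
    (∀ {x} → x ∈ xs → p x ≡ true → (ψ x ∈ ys × q (ψ x) ≡ true) × (φ (ψ x) ≡ x × g (ψ x) ≡ f x)) →
    (∀ {y} → y ∈ ys → q y ≡ true → (φ y ∈ xs × p (φ y) ≡ true) × ψ (φ y) ≡ y) →
    sum (map (λ x → if p x then f x else 0) xs) ≡ sum (map (λ y → if q y then g y else 0) ys)
  sum-if-bijection {xs} {ys} xs! ys! p q f g ψ φ forth back = begin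
    sum (map (λ x → if p x then f x else 0) xs)  ≡⟨ sum-map-filterᵇ p f xs ⟨
    sum (map f (filterᵇ p xs))                   ≡⟨ sum-map-cong-local f (g ∘ ψ) (sym ∘ proj₂ ∘ proj₂ ∘ forth′) ⟩
    sum (map (g ∘ ψ) (filterᵇ p xs))             ≡⟨ cong sum (map-∘ (filterᵇ p xs)) ⟩
    sum (map g (map ψ (filterᵇ p xs)))           ≡⟨ sum-↭ (↭-map⁺ g image↭) ⟩
    sum (map g (filterᵇ q ys))                   ≡⟨ sum-map-filterᵇ q g ys ⟩
    sum (map (λ y → if q y then g y else 0) ys)  ∎
    where
    open ≡-Reasoning
    forth′ : ∀ {x} → x ∈ filterᵇ p xs → (ψ x ∈ ys × q (ψ x) ≡ true) × (φ (ψ x) ≡ x × g (ψ x) ≡ f x)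
    forth′ x∈ = let (x∈xs , px) = ∈-filter⁻ (T? ∘ p) x∈ in forth x∈xs (Equivalence.to T-≡ px)
    back′ : ∀ {y} → y ∈ filterᵇ q ys → (φ y ∈ xs × p (φ y) ≡ true) × ψ (φ y) ≡ y
    back′ y∈ = let (y∈ys , qy) = ∈-filter⁻ (T? ∘ q) y∈ in back y∈ys (Equivalence.to T-≡ qy)
    ψ-injective : ∀ {x x′} → x ∈ filterᵇ p xs → x′ ∈ filterᵇ p xs → ψ x ≡ ψ x′ → x ≡ x′
    ψ-injective x∈ x′∈ eq =
      trans (sym (proj₁ (proj₂ (forth′ x∈)))) (trans (cong φ eq) (proj₁ (proj₂ (forth′ x′∈))))
    image⊆ : map ψ (filterᵇ p xs) ⊆ filterᵇ q ys
    image⊆ y∈ with x , x∈ , refl ← ∈-map⁻ ψ y∈ =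
      let ((ψx∈ , qψx) , _) = forth′ x∈ in ∈-filter⁺ (T? ∘ q) ψx∈ (Equivalence.from T-≡ qψx)
    image⊇ : filterᵇ q ys ⊆ map ψ (filterᵇ p xs)
    image⊇ y∈ = let ((φy∈ , pφy) , ψφy) = back′ y∈
                in subst (_∈ map ψ (filterᵇ p xs)) ψφy
                         (∈-map⁺ ψ (∈-filter⁺ (T? ∘ p) φy∈ (Equivalence.from T-≡ pφy)))
    image↭ : map ψ (filterᵇ p xs) ↭ filterᵇ q ys
    image↭ = Unique-⊆-⊇⇒↭ (Unique-map⁺ ψ ψ-injective (Unique-filterᵇ⁺ p xs!)) (Unique-filterᵇ⁺ q ys!)
                          image⊆ image⊇

sum-if-at-most-one : ∀ {A : Set} (p : A → Bool) (v : ℕ) {xs} → Unique xs →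
  (∀ {x y} → x ∈ xs → y ∈ xs → p x ≡ true → p y ≡ true → x ≡ y) →
  sum (map (λ x → if p x then v else 0) xs) ≡ (if any p xs then v else 0)
sum-if-at-most-one p v {[]}     _          _   = refl
sum-if-at-most-one p v {x ∷ xs} (x∉ ∷ xs!) one with p x in px
... | false = sum-if-at-most-one p v xs! (λ x∈ y∈ → one (there x∈) (there y∈))
... | true  = trans (cong (v +_) (sum-if-at-most-one p v xs! (λ x∈ y∈ → one (there x∈) (there y∈))))
                    (trans (cong (λ b → v + (if b then v else 0)) none) (+-identityʳ v))
  where
  none : any p xs ≡ false
  none = any-false⁺ p xs only-x
    where
    only-x : ∀ {y} → y ∈ xs → p y ≡ false
    only-x {y} y∈ with p y in py
    ... | false = refl
    ... | true  = ⊥-elim (All.lookup x∉ y∈ (one (here refl) (there y∈) px py))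

length-concatMap-const : {A B : Set} (g : A → List B) {k : ℕ} (xs : List A) →
  (∀ {x} → x ∈ xs → length (g x) ≡ k) → length (concatMap g xs) ≡ k * length xs
length-concatMap-const g {k} []       _      = sym (*-zeroʳ k)
length-concatMap-const g {k} (x ∷ xs) |g|≡k = begin
  length (g x ++ concatMap g xs)   ≡⟨ length-++ (g x) ⟩
  length (g x) + length (concatMap g xs) ≡⟨ cong₂ _+_ (|g|≡k (here refl)) (length-concatMap-const g xs (|g|≡k ∘ there)) ⟩
  k + k * length xs                ≡⟨ *-suc k (length xs) ⟨
  k * suc (length xs)              ∎
  where open ≡-Reasoning

length-∷ʳ : ∀ {A : Set} (u : List A) x → length (u ∷ʳ x) ≡ suc (length u)
length-∷ʳ u x = trans (length-++ u) (+-comm (length u) 1)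

∈[1‥]⁻ : ∀ {n x} → x ∈ [1‥ n ] → 1 ≤ x × x ≤ n
∈[1‥]⁻ {n} x∈ with k , k<n , refl ← ∈-applyUpTo⁻ suc x∈ = s≤s z≤n , k<n

∈[1‥]⁺ : ∀ {n x} → 1 ≤ x → x ≤ n → x ∈ [1‥ n ]
∈[1‥]⁺ {n} {suc k} _ k<n = ∈-applyUpTo⁺ suc k<n

Unique-[1‥] : ∀ n → Unique [1‥ n ]
Unique-[1‥] n = Unique.applyUpTo⁺₁ suc n (λ i<j _ → <⇒≢ (s≤s i<j))

∈[1‥1+n]⁻ : ∀ {n x} → x ∈ [1‥ suc n ] → x ∈ [1‥ n ] ⊎ x ≡ suc n
∈[1‥1+n]⁻ {n} x∈ with ∈[1‥]⁻ x∈
... | 1≤x , x≤1+n with m≤n⇒m<n∨m≡n x≤1+n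
... | inj₁ x<1+n = inj₁ (∈[1‥]⁺ 1≤x (≤-pred x<1+n))
... | inj₂ x≡1+n = inj₂ x≡1+n

[1‥n]⊆[1‥1+n] : ∀ {n} → [1‥ n ] ⊆ [1‥ suc n ]
[1‥n]⊆[1‥1+n] x∈ = let (1≤x , x≤n) = ∈[1‥]⁻ x∈ in ∈[1‥]⁺ 1≤x (m≤n⇒m≤1+n x≤n)

1+n∈[1‥1+n] : ∀ {n} → suc n ∈ [1‥ suc n ]
1+n∈[1‥1+n] = ∈[1‥]⁺ (s≤s z≤n) ≤-refl

∈-range⁻ : ∀ {a b x} → x ∈ range a b → a ≤ x × x < b
∈-range⁻ {a} {b} x∈ with k , k<b∸a , refl ← ∈-applyUpTo⁻ (a +_) x∈ = m≤m+n a k , +-<-∸ a b k<b∸a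
  where
  +-<-∸ : ∀ a b {k} → k < b ∸ a → a + k < b
  +-<-∸ zero    b       k<b   = k<b
  +-<-∸ (suc a) (suc b) k<b∸a = s≤s (+-<-∸ a b k<b∸a)

∈-range⁺ : ∀ {a b x} → a ≤ x → x < b → x ∈ range a b
∈-range⁺ {a} {b} a≤x x<b = subst (_∈ range a b) (m+[n∸m]≡n a≤x) (∈-applyUpTo⁺ (a +_) (∸-monoˡ-< x<b a≤x))

Unique-range : ∀ a b → Unique (range a b)
Unique-range a b = Unique.applyUpTo⁺₁ (a +_) (b ∸ a) (λ i<j _ → <⇒≢ (+-monoʳ-< a i<j))

range1⇒∈[1‥] : ∀ {n a} → a ∈ range 1 (suc n) → a ∈ [1‥ n ]
range1⇒∈[1‥] a∈ = let (1≤a , a<1+n) = ∈-range⁻ a∈ in ∈[1‥]⁺ 1≤a (≤-pred a<1+n)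

∈-insertAll : ∀ x as bs → as ++ x ∷ bs ∈ insertAll x (as ++ bs)
∈-insertAll x []       []       = here refl
∈-insertAll x []       (b ∷ bs) = here refl
∈-insertAll x (a ∷ as) bs       = there (∈-map⁺ (a ∷_) (∈-insertAll x as bs))

↭⇒∈perms : ∀ xs {ys} → ys ↭ xs → ys ∈ perms xs
↭⇒∈perms []       {[]}    _    = here refl
↭⇒∈perms []       {_ ∷ _} ys↭ with () ← ↭-length ys↭
↭⇒∈perms (x ∷ xs) {ys}    ys↭ with as , bs , refl ← ∈-∃++ (∈-resp-↭ (↭-sym ys↭) (here refl)) =
  ∈-concat⁺′ (∈-insertAll x as bs) (∈-map⁺ (insertAll x) (↭⇒∈perms xs (drop-mid as [] ys↭)))

length-insertAll : ∀ x ys → length (insertAll x ys) ≡ suc (length ys)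
length-insertAll x []       = refl
length-insertAll x (y ∷ ys) = cong suc (trans (length-map (y ∷_) (insertAll x ys)) (length-insertAll x ys))

∈-insertAll⇒length : ∀ x ys {zs} → zs ∈ insertAll x ys → length zs ≡ suc (length ys)
∈-insertAll⇒length x []       (here refl) = refl
∈-insertAll⇒length x (y ∷ ys) (here refl) = refl
∈-insertAll⇒length x (y ∷ ys) (there zs∈) with zs′ , zs′∈ , refl ← ∈-map⁻ (y ∷_) zs∈ =
  cong suc (∈-insertAll⇒length x ys zs′∈)

∈perms⇒length : ∀ xs {ys} → ys ∈ perms xs → length ys ≡ length xs
∈perms⇒length []       (here refl) = refl
∈perms⇒length (x ∷ xs) ys∈ with zs , ys∈zs , zs∈ ← ∈-concat⁻′ (map (insertAll x) (perms xs)) ys∈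
                             with ps , ps∈ , refl ← ∈-map⁻ (insertAll x) zs∈ =
  trans (∈-insertAll⇒length x ps ys∈zs) (cong suc (∈perms⇒length xs ps∈))

length-perms : ∀ xs → length (perms xs) ≡ length xs !
length-perms []       = refl
length-perms (x ∷ xs) = begin
  length (concatMap (insertAll x) (perms xs)) ≡⟨ length-concatMap-const (insertAll x) (perms xs) |insertAll| ⟩
  suc (length xs) * length (perms xs)         ≡⟨ cong (suc (length xs) *_) (length-perms xs) ⟩
  suc (length xs) * length xs !               ∎
  where
  open ≡-Reasoning
  |insertAll| : ∀ {ps} → ps ∈ perms xs → length (insertAll x ps) ≡ suc (length xs)
  |insertAll| {ps} ps∈ = trans (length-insertAll x ps) (cong suc (∈perms⇒length xs ps∈))

-- Standard cycle forms

Cycles : Set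
Cycles = List (List ℕ)

data Standard : Cycles → Set where
  []   : Standard []
  cons : ∀ {h t C} → All (h <_) t → All (All (h <_)) C → Standard C → Standard ((h ∷ t) ∷ C)

record IsCycleForm (n : ℕ) (C : Cycles) : Set where
  field
    standard : Standard C
    unique   : Unique (concat C)
    sound    : concat C ⊆ [1‥ n ]
    complete : [1‥ n ] ⊆ concat C

  <1+n : ∀ {x} → x ∈ concat C → x < suc n
  <1+n x∈ = s≤s (proj₂ (∈[1‥]⁻ (sound x∈)))

  1+n∉ : suc n ∉ concat C
  1+n∉ n∈ = <-irrefl refl (<1+n n∈)

open IsCycleForm public

concat-∷ʳ : ∀ (C : Cycles) c → concat (C ∷ʳ c) ≡ concat C ++ c
concat-∷ʳ C c = trans (sym (concat-++ C [ c ])) (cong (concat C ++_) (++-identityʳ c))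

insertAfter : ℕ → ℕ → List ℕ → List ℕ
insertAfter a n []      = []
insertAfter a n (x ∷ w) = x ∷ (if x ≡ᵇ a then n ∷ insertAfter a n w else insertAfter a n w)

extensions : ℕ → Cycles → List Cycles
extensions n C = (C ∷ʳ [ n ]) ∷ map (λ a → map (insertAfter a n) C) (range 1 n)

cycleForms : ℕ → List Cycles
cycleForms zero    = [ [] ]
cycleForms (suc m) = concatMap (extensions (suc m)) (cycleForms m)

length-cycleForms : ∀ n → length (cycleForms n) ≡ n !
length-cycleForms zero    = refl
length-cycleForms (suc m) = begin
  length (concatMap (extensions (suc m)) (cycleForms m))
    ≡⟨ length-concatMap-const (extensions (suc m)) (cycleForms m) (λ _ → |extensions|) ⟩
  suc m * length (cycleForms m)
    ≡⟨ cong (suc m *_) (length-cycleForms m) ⟩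
  suc m * m !                                            ∎
  where
  open ≡-Reasoning
  |extensions| : ∀ {C} → length (extensions (suc m) C) ≡ suc m
  |extensions| {C} = cong suc (trans (length-map (λ a → map (insertAfter a (suc m)) C) (range 1 (suc m)))
                                     (length-applyUpTo (1 +_) m))

module _ (a n : ℕ) where

  insertAfter-++ : ∀ u v → insertAfter a n (u ++ v) ≡ insertAfter a n u ++ insertAfter a n v
  insertAfter-++ []      v = refl
  insertAfter-++ (x ∷ u) v with x ≡ᵇ a
  ... | true  = cong (λ w → x ∷ n ∷ w) (insertAfter-++ u v)
  ... | false = cong (x ∷_) (insertAfter-++ u v)

  concat-insertAfter : ∀ C → concat (map (insertAfter a n) C) ≡ insertAfter a n (concat C)
  concat-insertAfter []      = refl
  concat-insertAfter (c ∷ C) = trans (cong (insertAfter a n c ++_) (concat-insertAfter C)) (sym (insertAfter-++ c (concat C)))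

  ∈-insertAfter⁻ : ∀ w {y} → y ∈ insertAfter a n w → y ∈ w ⊎ y ≡ n
  ∈-insertAfter⁻ (x ∷ w) y∈ with x ≡ᵇ a | y∈
  ... | true  | here refl         = inj₁ (here refl)
  ... | true  | there (here refl) = inj₂ refl
  ... | false | here refl         = inj₁ (here refl)
  ... | true  | there (there y∈w) = map₁ there (∈-insertAfter⁻ w y∈w)
  ... | false | there y∈w         = map₁ there (∈-insertAfter⁻ w y∈w)

  ∈-insertAfter⁺ : ∀ w {y} → y ∈ w → y ∈ insertAfter a n w
  ∈-insertAfter⁺ (x ∷ w) y∈ with x ≡ᵇ a | y∈
  ... | true  | here refl = here refl
  ... | false | here refl = here refl
  ... | true  | there y∈w = there (there (∈-insertAfter⁺ w y∈w))
  ... | false | there y∈w = there (∈-insertAfter⁺ w y∈w)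

  n∈insertAfter : ∀ w → a ∈ w → n ∈ insertAfter a n w
  n∈insertAfter (x ∷ w) a∈ with x ≡ᵇ a in x≡ᵇa | a∈
  ... | true  | _         = there (here refl)
  ... | false | here refl rewrite ≡ᵇ-refl a with () ← x≡ᵇa
  ... | false | there a∈w = there (n∈insertAfter w a∈w)

  insertAfter-∉ : ∀ w → a ∉ w → insertAfter a n w ≡ w
  insertAfter-∉ []      _  = refl
  insertAfter-∉ (x ∷ w) a∉ rewrite ≢⇒≡ᵇ-false {x} {a} (λ x≡a → a∉ (here (sym x≡a))) =
    cong (x ∷_) (insertAfter-∉ w (a∉ ∘ there))

  Unique-insertAfter : ∀ w → Unique w → n ∉ w → Unique (insertAfter a n w)
  Unique-insertAfter []      _          _  = []
  Unique-insertAfter (x ∷ w) (x∉ ∷ w!) n∉ with x ≡ᵇ a in eq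
  ... | true  with refl ← ≡ᵇ-true⇒≡ {x} {a} eq rewrite insertAfter-∉ w (Unique[x∷xs]⇒x∉xs (x∉ ∷ w!)) =
    Unique-∷⁺ (λ { (here x≡n) → n∉ (here (sym x≡n)) ; (there x∈w) → Unique[x∷xs]⇒x∉xs (x∉ ∷ w!) x∈w })
              (Unique-∷⁺ (n∉ ∘ there) w!)
  ... | false =
    Unique-∷⁺ ([ Unique[x∷xs]⇒x∉xs (x∉ ∷ w!) , (λ x≡n → n∉ (here (sym x≡n))) ]′ ∘ ∈-insertAfter⁻ w)
              (Unique-insertAfter w w! (n∉ ∘ there))

  All-insertAfter : ∀ {P : ℕ → Set} w → All P w → P n → All P (insertAfter a n w)
  All-insertAfter []      []         _  = []
  All-insertAfter (x ∷ w) (px ∷ pw) pn with x ≡ᵇ a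
  ... | true  = px ∷ pn ∷ All-insertAfter w pw pn
  ... | false = px ∷ All-insertAfter w pw pn

  Standard-insertAfter : ∀ C → Standard C → (∀ {x} → x ∈ concat C → x < n) → Standard (map (insertAfter a n) C)
  Standard-insertAfter []            []                  _   = []
  Standard-insertAfter ((h ∷ t) ∷ C) (cons h<t h<C std) <n with h ≡ᵇ a
  ... | true  = cons (<n (here refl) ∷ All-insertAfter t h<t (<n (here refl)))
                     (All.map⁺ (All.map (λ h<c → All-insertAfter _ h<c (<n (here refl))) h<C))
                     (Standard-insertAfter C std (<n ∘ ∈-++⁺ʳ (h ∷ t)))
  ... | false = cons (All-insertAfter t h<t (<n (here refl)))
                     (All.map⁺ (All.map (λ h<c → All-insertAfter _ h<c (<n (here refl))) h<C))
                     (Standard-insertAfter C std (<n ∘ ∈-++⁺ʳ (h ∷ t)))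

Standard-∷ʳ : ∀ n C → Standard C → (∀ {x} → x ∈ concat C → x < n) → Standard (C ∷ʳ [ n ])
Standard-∷ʳ n []            []                 _  = cons [] [] []
Standard-∷ʳ n ((h ∷ t) ∷ C) (cons h<t h<C std) <n =
  cons h<t (All.++⁺ h<C ((<n (here refl) ∷ []) ∷ [])) (Standard-∷ʳ n C std (<n ∘ ∈-++⁺ʳ (h ∷ t)))

module _ {m : ℕ} {C : Cycles} (C-form : IsCycleForm m C) where

  IsCycleForm-extend : ∀ {D} → Standard D → Unique (concat D) →
    (∀ {x} → x ∈ concat D → x ∈ concat C ⊎ x ≡ suc m) → concat C ⊆ concat D → suc m ∈ concat D →
    IsCycleForm (suc m) D
  IsCycleForm-extend {D} D-std D! D⊆ C⊆D 1+m∈D = record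
    { standard = D-std
    ; unique   = D!
    ; sound    = [ [1‥n]⊆[1‥1+n] ∘ sound C-form , (λ { refl → 1+n∈[1‥1+n] }) ]′ ∘ D⊆
    ; complete = [ C⊆D ∘ complete C-form , (λ { refl → 1+m∈D }) ]′ ∘ ∈[1‥1+n]⁻
    }

  IsCycleForm-∷ʳ : IsCycleForm (suc m) (C ∷ʳ [ suc m ])
  IsCycleForm-∷ʳ = IsCycleForm-extend
    (Standard-∷ʳ (suc m) C (standard C-form) (<1+n C-form))
    (subst Unique concat≡ (Unique-++⁺ (unique C-form) (Unique-∷⁺ (λ ()) []) λ { x∈C (here refl) → 1+n∉ C-form x∈C }))
    (map₂ (λ { (here refl) → refl }) ∘ ∈-++⁻ (concat C) ∘ subst (_ ∈_) (sym concat≡))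
    (subst (_ ∈_) concat≡ ∘ ∈-++⁺ˡ)
    (subst (_ ∈_) concat≡ (∈-++⁺ʳ (concat C) (here refl)))
    where
    concat≡ : concat C ++ [ suc m ] ≡ concat (C ∷ʳ [ suc m ])
    concat≡ = trans (cong (concat C ++_) (sym (++-identityʳ [ suc m ]))) (concat-++ C [ [ suc m ] ])

  IsCycleForm-insertAfter : ∀ {a} → a ∈ range 1 (suc m) → IsCycleForm (suc m) (map (insertAfter a (suc m)) C)
  IsCycleForm-insertAfter {a} a∈ = IsCycleForm-extend
    (Standard-insertAfter a (suc m) C (standard C-form) (<1+n C-form))
    (subst Unique (sym concat≡) (Unique-insertAfter a (suc m) (concat C) (unique C-form) (1+n∉ C-form)))
    (∈-insertAfter⁻ a (suc m) (concat C) ∘ subst (_ ∈_) concat≡)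
    (subst (_ ∈_) (sym concat≡) ∘ ∈-insertAfter⁺ a (suc m) (concat C))
    (subst (_ ∈_) (sym concat≡) (n∈insertAfter a (suc m) (concat C) (complete C-form (range1⇒∈[1‥] a∈))))
    where
    concat≡ : concat (map (insertAfter a (suc m)) C) ≡ insertAfter a (suc m) (concat C)
    concat≡ = concat-insertAfter a (suc m) C

∈cycleForms⇒IsCycleForm : ∀ n {C} → C ∈ cycleForms n → IsCycleForm n C
∈cycleForms⇒IsCycleForm zero    (here refl) = record { standard = [] ; unique = [] ; sound = λ () ; complete = λ () }
∈cycleForms⇒IsCycleForm (suc m) C∈ with D , C∈D , D∈ ← ∈-concat⁻′ (map (extensions (suc m)) (cycleForms m)) C∈
                                    with C′ , C′∈ , refl ← ∈-map⁻ (extensions (suc m)) D∈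
                                    with C∈D
... | here refl = IsCycleForm-∷ʳ (∈cycleForms⇒IsCycleForm m C′∈)
... | there C∈ with a , a∈ , refl ← ∈-map⁻ _ C∈ = IsCycleForm-insertAfter (∈cycleForms⇒IsCycleForm m C′∈) a∈

removeEntry : ℕ → Cycles → Cycles
removeEntry n C = filterᵇ (not ∘ null) (map (filterᵇ (λ x → not (x ≡ᵇ n))) C)

filterᵇ-≢-∉ : ∀ n w → n ∉ w → filterᵇ (λ x → not (x ≡ᵇ n)) w ≡ w
filterᵇ-≢-∉ n w n∉ =
  filter-all _ (All.tabulate λ {x} x∈ → ≡ᵇ-false⇒T (≢⇒≡ᵇ-false {x} {n} (λ { refl → n∉ x∈ })))
  where
  ≡ᵇ-false⇒T : ∀ {b} → b ≡ false → T (not b)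
  ≡ᵇ-false⇒T refl = _

removeEntry-map : ∀ n (f : List ℕ → List ℕ) C → Standard C →
  (∀ {c} → c ∈ C → filterᵇ (λ x → not (x ≡ᵇ n)) (f c) ≡ c) → removeEntry n (map f C) ≡ C
removeEntry-map n f []            []                _   = refl
removeEntry-map n f ((h ∷ t) ∷ C) (cons _ _ C-std) f≡ rewrite f≡ (here refl) =
  cong ((h ∷ t) ∷_) (removeEntry-map n f C C-std (f≡ ∘ there))

removeEntry-∷ʳ : ∀ n C → Standard C → n ∉ concat C → removeEntry n (C ∷ʳ [ n ]) ≡ C
removeEntry-∷ʳ n []            []                _  rewrite ≡ᵇ-refl n = refl
removeEntry-∷ʳ n ((h ∷ t) ∷ C) (cons _ _ C-std) n∉ rewrite filterᵇ-≢-∉ n (h ∷ t) (n∉ ∘ ∈-++⁺ˡ) =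
  cong ((h ∷ t) ∷_) (removeEntry-∷ʳ n C C-std (n∉ ∘ ∈-++⁺ʳ (h ∷ t)))

removeEntry-insertAfter : ∀ a n C → Standard C → n ∉ concat C → removeEntry n (map (insertAfter a n) C) ≡ C
removeEntry-insertAfter a n C C-std n∉ =
  removeEntry-map n (insertAfter a n) C C-std λ c∈ → filterᵇ-≢-insertAfter _ (λ n∈c → n∉ (∈-concat⁺′ n∈c c∈))
  where
  filterᵇ-≢-insertAfter : ∀ w → n ∉ w → filterᵇ (λ x → not (x ≡ᵇ n)) (insertAfter a n w) ≡ w
  filterᵇ-≢-insertAfter []      _  = refl
  filterᵇ-≢-insertAfter (x ∷ w) n∉ with x ≡ᵇ a
  ... | true  rewrite ≢⇒≡ᵇ-false {x} {n} (λ { refl → n∉ (here refl) }) | ≡ᵇ-refl n =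
    cong (x ∷_) (filterᵇ-≢-insertAfter w (n∉ ∘ there))
  ... | false rewrite ≢⇒≡ᵇ-false {x} {n} (λ { refl → n∉ (here refl) }) =
    cong (x ∷_) (filterᵇ-≢-insertAfter w (n∉ ∘ there))

predecessor : ℕ → List ℕ → ℕ
predecessor n (x ∷ y ∷ w) = if y ≡ᵇ n then x else predecessor n (y ∷ w)
predecessor n _           = 0

predecessor-insertAfter : ∀ a n w → n ∉ w → a ∈ w → predecessor n (insertAfter a n w) ≡ a
predecessor-insertAfter a n (x ∷ w) n∉ a∈ with x ≡ᵇ a in x≡ᵇa | a∈
... | true  | _ rewrite ≡ᵇ-refl n = ≡ᵇ-true⇒≡ x≡ᵇa
... | false | here refl rewrite ≡ᵇ-refl a with () ← x≡ᵇa
predecessor-insertAfter a n (x ∷ y ∷ w) n∉ a∈ | false | there a∈w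
  rewrite ≢⇒≡ᵇ-false {y} {n} (λ { refl → n∉ (there (here refl)) }) =
  predecessor-insertAfter a n (y ∷ w) (n∉ ∘ there) a∈w

Unique-extensions : ∀ {m C} → IsCycleForm m C → Unique (extensions (suc m) C)
Unique-extensions {m} {C} C-form =
  Unique-∷⁺ ∷ʳ∉ (Unique-map⁺ (λ a → map (insertAfter a (suc m)) C) insertAfter-injective (Unique-range 1 (suc m)))
  where
  ∷ʳ∉ : C ∷ʳ [ suc m ] ∉ map (λ a → map (insertAfter a (suc m)) C) (range 1 (suc m))
  ∷ʳ∉ ∈map with a , _ , eq ← ∈-map⁻ _ ∈map = 1+n≢n (begin
    suc (length C)                          ≡⟨ +-comm 1 (length C) ⟩
    length C + 1                            ≡⟨ length-++ C ⟨
    length (C ∷ʳ [ suc m ])                 ≡⟨ cong length eq ⟩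
    length (map (insertAfter a (suc m)) C)  ≡⟨ length-map (insertAfter a (suc m)) C ⟩
    length C                                ∎)
    where open ≡-Reasoning
  predecessor≡ : ∀ {a} → a ∈ range 1 (suc m) → predecessor (suc m) (concat (map (insertAfter a (suc m)) C)) ≡ a
  predecessor≡ {a} a∈ = trans (cong (predecessor (suc m)) (concat-insertAfter a (suc m) C))
    (predecessor-insertAfter a (suc m) (concat C) (1+n∉ C-form) (complete C-form (range1⇒∈[1‥] a∈)))
  insertAfter-injective : ∀ {a b} → a ∈ range 1 (suc m) → b ∈ range 1 (suc m) →
    map (insertAfter a (suc m)) C ≡ map (insertAfter b (suc m)) C → a ≡ b
  insertAfter-injective a∈ b∈ eq =
    trans (sym (predecessor≡ a∈)) (trans (cong (predecessor (suc m) ∘ concat) eq) (predecessor≡ b∈))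

Unique-cycleForms : ∀ n → Unique (cycleForms n)
Unique-cycleForms zero    = Unique-∷⁺ (λ ()) []
Unique-cycleForms (suc m) = Unique-concatMap⁺ (extensions (suc m)) (Unique-cycleForms m)
  (Unique-extensions ∘ ∈cycleForms⇒IsCycleForm m)
  (λ C∈ C′∈ D∈ D∈′ → trans (sym (removeEntry-extension C∈ D∈)) (removeEntry-extension C′∈ D∈′))
  where
  removeEntry-extension : ∀ {C D} → C ∈ cycleForms m → D ∈ extensions (suc m) C → removeEntry (suc m) D ≡ C
  removeEntry-extension {C} C∈ (here refl) =
    removeEntry-∷ʳ (suc m) C (standard (∈cycleForms⇒IsCycleForm m C∈)) (1+n∉ (∈cycleForms⇒IsCycleForm m C∈))
  removeEntry-extension {C} C∈ (there D∈) with a , _ , refl ← ∈-map⁻ _ D∈ =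
    removeEntry-insertAfter a (suc m) C (standard (∈cycleForms⇒IsCycleForm m C∈)) (1+n∉ (∈cycleForms⇒IsCycleForm m C∈))

-- From a cycle form to its permutation

cycleSucc : ℕ → List ℕ → ℕ → ℕ
cycleSucc h []          x = 0
cycleSucc h (a ∷ [])    x = h
cycleSucc h (a ∷ b ∷ w) x = if a ≡ᵇ x then b else cycleSucc h (b ∷ w) x

successorIn : List ℕ → ℕ → ℕ
successorIn []      x = 0
successorIn (h ∷ t) x = cycleSucc h (h ∷ t) x

successor : Cycles → ℕ → ℕ
successor []      x = 0
successor (c ∷ C) x = if x ∈ᵇ c then successorIn c x else successor C x

toOneLine : ℕ → Cycles → List ℕ
toOneLine n C = map (successor C) [1‥ n ]

map-cycleSucc : ∀ h a s → Unique (a ∷ s) → map (cycleSucc h (a ∷ s)) (a ∷ s) ≡ s ∷ʳ h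
map-cycleSucc h a []      _          = refl
map-cycleSucc h a (b ∷ s) (a∉ ∷ bs!) rewrite ≡ᵇ-refl a = cong (b ∷_) (begin
  map (cycleSucc h (a ∷ b ∷ s)) (b ∷ s) ≡⟨ map-cong-local (All.map skip-a a∉) ⟩
  map (cycleSucc h (b ∷ s)) (b ∷ s)     ≡⟨ map-cycleSucc h b s bs! ⟩
  s ∷ʳ h                                ∎)
  where
  open ≡-Reasoning
  skip-a : ∀ {x} → a ≢ x → cycleSucc h (a ∷ b ∷ s) x ≡ cycleSucc h (b ∷ s) x
  skip-a {x} a≢x = cong (λ c → if c then b else cycleSucc h (b ∷ s) x) (≢⇒≡ᵇ-false a≢x)

successor-∈ : ∀ {C c x} → Unique (concat C) → c ∈ C → x ∈ c → successor C x ≡ successorIn c x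
successor-∈ {c ∷ C} {x = x} _ (here refl) x∈c rewrite ∈⇒∈ᵇ c x∈c = refl
successor-∈ {c′ ∷ C} {x = x} C! (there c∈C) x∈c
  rewrite ∉⇒∈ᵇ-false c′ (λ x∈c′ → Unique-++⇒disjoint c′ C! x∈c′ (∈-concat⁺′ x∈c c∈C)) =
  successor-∈ (Unique-++⁻ʳ c′ C!) c∈C x∈c

map-successor : ∀ {C h t} → Unique (concat C) → (h ∷ t) ∈ C → map (successor C) (h ∷ t) ≡ t ∷ʳ h
map-successor {C} {h} {t} C! c∈C = begin
  map (successor C) (h ∷ t)            ≡⟨ map-cong-local (All.tabulate (successor-∈ C! c∈C)) ⟩
  map (cycleSucc h (h ∷ t)) (h ∷ t)    ≡⟨ map-cycleSucc h h t (Unique-concat⁻ C! c∈C) ⟩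
  t ∷ʳ h                               ∎
  where open ≡-Reasoning

app-toOneLine : ∀ n C {x} → x ∈ [1‥ n ] → app (toOneLine n C) x ≡ successor C x
app-toOneLine n C x∈ with k , k<n , refl ← ∈-applyUpTo⁻ suc x∈ =
  trans (cong (λ π → app π (suc k)) (map-applyUpTo suc (successor C) n)) (app-applyUpTo _ n k<n)
  where
  app-applyUpTo : ∀ (g : ℕ → ℕ) n {k} → k < n → app (applyUpTo g n) (suc k) ≡ g k
  app-applyUpTo g (suc n) {zero}  _         = refl
  app-applyUpTo g (suc n) {suc k} (s≤s k<n) = app-applyUpTo (g ∘ suc) n k<n

cycleFrom-cycle : ∀ π h a s fuel → map (app π) (a ∷ s) ≡ s ∷ʳ h → h ∉ s → length s < fuel →
                  cycleFrom π fuel h a ≡ a ∷ s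
cycleFrom-cycle π h a []      (suc fuel) πa≡h _ _ rewrite proj₁ (∷-injective πa≡h) | ≡ᵇ-refl h = refl
cycleFrom-cycle π h a (b ∷ s) (suc fuel) π[a∷s]≡ h∉ (s≤s s<fuel)
  with πa≡b , π[s]≡ ← ∷-injective π[a∷s]≡
  rewrite trans (cong (_≡ᵇ h) πa≡b) (≢⇒≡ᵇ-false {b} {h} (λ { refl → h∉ (here refl) })) =
  cong (a ∷_) (trans (cong (cycleFrom π fuel h) πa≡b) (cycleFrom-cycle π h b s fuel π[s]≡ (h∉ ∘ there) s<fuel))

Standard-head≤ : ∀ {h t E x} → Standard ((h ∷ t) ∷ E) → x ∈ concat ((h ∷ t) ∷ E) → h ≤ x
Standard-head≤ _                  (here refl) = ≤-refl
Standard-head≤ {t = t} (cons h<t h<E _) (there x∈) with ∈-++⁻ t x∈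
... | inj₁ x∈t = <⇒≤ (All.lookup h<t x∈t)
... | inj₂ x∈E = <⇒≤ (All.lookup (All.concat⁺ h<E) x∈E)

module _ (π : List ℕ) (n : ℕ) where

  cyclesAux-reads : ∀ E seen ks → Standard E → Unique (concat E) → AllPairs _<_ ks → concat E ⊆ ks →
    (∀ {x} → x ∈ ks → x ∈ seen ⊎ x ∈ concat E) → (∀ {x} → x ∈ seen → x ∉ concat E) →
    (∀ {h t} → (h ∷ t) ∈ E → cycleFrom π n h h ≡ h ∷ t) → cyclesAux π n seen ks ≡ E
  cyclesAux-reads []            seen [] _ _ _ _ _ _ _ = refl
  cyclesAux-reads ((h ∷ t) ∷ E) seen [] _ _ _ E⊆ _ _ _ with () ← E⊆ (here refl)
  cyclesAux-reads E seen (k ∷ ks) E-std E! (k< ∷ ks<) E⊆ covered apart cycles with k ∈ᵇ seen in k∈ᵇ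
  ... | true = cyclesAux-reads E seen ks E-std E! ks< E⊆ks (covered ∘ there) apart cycles
    where
    E⊆ks : concat E ⊆ ks
    E⊆ks x∈ with E⊆ x∈
    ... | here refl = ⊥-elim (apart (∈ᵇ⇒∈ seen k∈ᵇ) x∈)
    ... | there x∈ks = x∈ks
  ... | false with covered (here refl)
  ...   | inj₁ k∈seen = ⊥-elim (false≢true (trans (sym k∈ᵇ) (∈⇒∈ᵇ seen k∈seen)))
  cyclesAux-reads ((h ∷ t) ∷ E) seen (k ∷ ks) (cons h<t h<E E-std) E! (k< ∷ ks<) E⊆ covered apart cycles
    | false | inj₂ k∈E with E⊆ (here refl)
  ... | there h∈ks = ⊥-elim (<⇒≱ (All.lookup k< h∈ks) (Standard-head≤ (cons h<t h<E E-std) k∈E))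
  ... | here refl
    rewrite cycles (here refl) =
    cong ((h ∷ t) ∷_) (cyclesAux-reads E (seen ++ h ∷ t) ks E-std (Unique-++⁻ʳ (h ∷ t) E!) ks< E⊆ks covered′ apart′
                                       (cycles ∘ there))
    where
    E⊆ks : concat E ⊆ ks
    E⊆ks x∈ with E⊆ (∈-++⁺ʳ (h ∷ t) x∈)
    ... | here refl  = ⊥-elim (<-irrefl refl (All.lookup (All.concat⁺ h<E) x∈))
    ... | there x∈ks = x∈ks
    covered′ : ∀ {x} → x ∈ ks → x ∈ seen ++ h ∷ t ⊎ x ∈ concat E
    covered′ x∈ with covered (there x∈)
    ... | inj₁ x∈seen = inj₁ (∈-++⁺ˡ x∈seen)
    ... | inj₂ x∈hE with ∈-++⁻ (h ∷ t) x∈hE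
    ...   | inj₁ x∈h∷t = inj₁ (∈-++⁺ʳ seen x∈h∷t)
    ...   | inj₂ x∈E   = inj₂ x∈E
    apart′ : ∀ {x} → x ∈ seen ++ h ∷ t → x ∉ concat E
    apart′ x∈ with ∈-++⁻ seen x∈
    ... | inj₁ x∈seen = apart x∈seen ∘ ∈-++⁺ʳ (h ∷ t)
    ... | inj₂ x∈h∷t  = Unique-++⇒disjoint (h ∷ t) E! x∈h∷t

module _ {n : ℕ} {C : Cycles} (C-form : IsCycleForm n C) where

  private
    ∈cycle⇒∈[1‥n] : ∀ {c x} → c ∈ C → x ∈ c → x ∈ [1‥ n ]
    ∈cycle⇒∈[1‥n] c∈ x∈ = sound C-form (∈-concat⁺′ x∈ c∈)

  map-app-toOneLine : ∀ {h t} → (h ∷ t) ∈ C → map (app (toOneLine n C)) (h ∷ t) ≡ t ∷ʳ h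
  map-app-toOneLine c∈ = trans (map-cong-local (All.tabulate (app-toOneLine n C ∘ ∈cycle⇒∈[1‥n] c∈)))
                               (map-successor (unique C-form) c∈)

  cycleForm-toOneLine : cycleForm n (toOneLine n C) ≡ C
  cycleForm-toOneLine = cyclesAux-reads (toOneLine n C) n C [] [1‥ n ]
    (standard C-form) (unique C-form) (AllPairs.applyUpTo⁺₁ suc n (λ i<j _ → s≤s i<j))
    (sound C-form) (inj₂ ∘ complete C-form) (λ ()) reads-cycle
    where
    reads-cycle : ∀ {h t} → (h ∷ t) ∈ C → cycleFrom (toOneLine n C) n h h ≡ h ∷ t
    reads-cycle {h} {t} c∈ = cycleFrom-cycle (toOneLine n C) h h t n (map-app-toOneLine c∈)
      (Unique[x∷xs]⇒x∉xs (Unique-concat⁻ (unique C-form) c∈))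
      (subst (length (h ∷ t) ≤_) (length-applyUpTo suc n)
             (Unique-⊆⇒length≤ (Unique-concat⁻ (unique C-form) c∈) (∈cycle⇒∈[1‥n] c∈)))

map-successor-concat↭ : ∀ {C} E → Unique (concat C) → (∀ {c} → c ∈ E → c ∈ C) →
                        map (successor C) (concat E) ↭ concat E
map-successor-concat↭         []            _  _   = ↭-refl
map-successor-concat↭         ([] ∷ E)      C! E⊆C = map-successor-concat↭ E C! (E⊆C ∘ there)
map-successor-concat↭ {C} ((h ∷ t) ∷ E) C! E⊆C = begin
  map (successor C) ((h ∷ t) ++ concat E)              ≡⟨ map-++ (successor C) (h ∷ t) (concat E) ⟩
  map (successor C) (h ∷ t) ++ map (successor C) (concat E) ≡⟨ cong (_++ _) (map-successor C! (E⊆C (here refl))) ⟩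
  (t ∷ʳ h) ++ map (successor C) (concat E)
    ↭⟨ ++⁺ (↭-sym (∷↭∷ʳ h t)) (map-successor-concat↭ E C! (E⊆C ∘ there)) ⟩
  (h ∷ t) ++ concat E                                  ∎
  where open PermutationReasoning

toOneLine↭ : ∀ {n C} → IsCycleForm n C → toOneLine n C ↭ [1‥ n ]
toOneLine↭ {n} {C} C-form = begin
  map (successor C) [1‥ n ]       ↭⟨ ↭-map⁺ (successor C) [1‥n]↭C ⟩
  map (successor C) (concat C)    ↭⟨ map-successor-concat↭ C (unique C-form) id ⟩
  concat C                        ↭⟨ [1‥n]↭C ⟨
  [1‥ n ]                         ∎
  where
  open PermutationReasoning
  [1‥n]↭C : [1‥ n ] ↭ concat C
  [1‥n]↭C = Unique-⊆-⊇⇒↭ (Unique-[1‥] n) (unique C-form) (complete C-form) (sound C-form)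

toOneLine∈permutations : ∀ {n C} → IsCycleForm n C → toOneLine n C ∈ permutations n
toOneLine∈permutations C-form = ↭⇒∈perms _ (toOneLine↭ C-form)

moves : (ℕ → ℕ) → ℕ → Bool
moves f x = not (f x ≡ᵇ x)

derangedCycles : Cycles → Bool
derangedCycles C = all (λ c → 2 ≤ᵇ length c) C

all-moves-rotation : ∀ f h a s → map f (a ∷ s) ≡ s ∷ʳ h → Unique (a ∷ s) → h ∉ a ∷ s →
                     all (moves f) (a ∷ s) ≡ true
all-moves-rotation f h a []      fa≡h _          h∉
  rewrite proj₁ (∷-injective fa≡h) | ≢⇒≡ᵇ-false {h} {a} (λ { refl → h∉ (here refl) }) = refl
all-moves-rotation f h a (b ∷ s) f≡       (a∉ ∷ bs!) h∉ with fa≡b , fs≡ ← ∷-injective f≡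
  rewrite fa≡b | ≢⇒≡ᵇ-false {b} {a} (λ { refl → All.lookup a∉ (here refl) refl }) =
  all-moves-rotation f h b s fs≡ bs! (h∉ ∘ there)

all-moves-cycle : ∀ f h t → map f (h ∷ t) ≡ t ∷ʳ h → Unique (h ∷ t) →
                  all (moves f) (h ∷ t) ≡ (2 ≤ᵇ length (h ∷ t))
all-moves-cycle f h []      fh≡h _ rewrite proj₁ (∷-injective fh≡h) | ≡ᵇ-refl h = refl
all-moves-cycle f h (b ∷ t) f≡   (h∉ ∷ bt!) with fh≡b , ft≡ ← ∷-injective f≡
  rewrite fh≡b | ≢⇒≡ᵇ-false {b} {h} (λ { refl → All.lookup h∉ (here refl) refl }) =
  all-moves-rotation f h b t ft≡ bt! (λ h∈ → All.lookup h∉ h∈ refl)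

isDerangement-toOneLine : ∀ {n C} → IsCycleForm n C → isDerangement n (toOneLine n C) ≡ derangedCycles C
isDerangement-toOneLine {n} {C} C-form = begin
  all (moves (app (toOneLine n C))) [1‥ n ]
    ≡⟨ cong and (map-cong-local (All.tabulate λ x∈ → cong (λ y → not (y ≡ᵇ _)) (app-toOneLine n C x∈))) ⟩
  all (moves (successor C)) [1‥ n ]         ≡⟨ all-⊆-⊇ (moves (successor C)) (complete C-form) (sound C-form) ⟩
  all (moves (successor C)) (concat C)      ≡⟨ per-cycle C (standard C-form) id ⟩
  derangedCycles C                          ∎
  where
  open ≡-Reasoning
  per-cycle : ∀ E → Standard E → (∀ {c} → c ∈ E → c ∈ C) → all (moves (successor C)) (concat E) ≡ derangedCycles E
  per-cycle []            []                 _   = refl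
  per-cycle ((h ∷ t) ∷ E) (cons _ _ E-std) E⊆C = trans (all-++ (moves (successor C)) (h ∷ t))
    (cong₂ _∧_ (all-moves-cycle (successor C) h t (map-successor (unique C-form) (E⊆C (here refl)))
                                (Unique-concat⁻ (unique C-form) (E⊆C (here refl))))
               (per-cycle E E-std (E⊆C ∘ there)))

toOneLine-injective : ∀ {n C D} → IsCycleForm n C → IsCycleForm n D → toOneLine n C ≡ toOneLine n D → C ≡ D
toOneLine-injective {n} C-form D-form eq =
  trans (sym (cycleForm-toOneLine C-form)) (trans (cong (cycleForm n) eq) (cycleForm-toOneLine D-form))

map-toOneLine↭permutations : ∀ n → map (toOneLine n) (cycleForms n) ↭ permutations n
map-toOneLine↭permutations n = Unique-⊆-length⇒↭
  (Unique-map⁺ (toOneLine n) (λ C∈ D∈ → toOneLine-injective (form C∈) (form D∈)) (Unique-cycleForms n))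
  (λ π∈ → let (C , C∈ , π≡) = ∈-map⁻ (toOneLine n) π∈
          in subst (_∈ permutations n) (sym π≡) (toOneLine∈permutations (form C∈)))
  (≤-reflexive (begin
    length (permutations n)                     ≡⟨ length-perms [1‥ n ] ⟩
    length [1‥ n ] !                            ≡⟨ cong _! (length-applyUpTo _ n) ⟩
    n !                                         ≡⟨ length-cycleForms n ⟨
    length (cycleForms n)                       ≡⟨ length-map (toOneLine n) (cycleForms n) ⟨
    length (map (toOneLine n) (cycleForms n))   ∎))
  where
  open ≡-Reasoning
  form : ∀ {C} → C ∈ cycleForms n → IsCycleForm n C
  form = ∈cycleForms⇒IsCycleForm n

IsCycleForm⇒∈cycleForms : ∀ {n C} → IsCycleForm n C → C ∈ cycleForms n
IsCycleForm⇒∈cycleForms {n} C-form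
  with D , D∈ , eq ← ∈-map⁻ (toOneLine n)
                       (∈-resp-↭ (↭-sym (map-toOneLine↭permutations n)) (toOneLine∈permutations C-form)) =
  subst (_∈ cycleForms n) (toOneLine-injective (∈cycleForms⇒IsCycleForm n D∈) C-form (sym eq)) D∈

sum-permutations : ∀ n (F : List ℕ → ℕ) → sum (map F (permutations n)) ≡ sum (map (F ∘ toOneLine n) (cycleForms n))
sum-permutations n F = begin
  sum (map F (permutations n))                       ≡⟨ sum-↭ (↭-map⁺ F (map-toOneLine↭permutations n)) ⟨
  sum (map F (map (toOneLine n) (cycleForms n)))     ≡⟨ cong sum (map-∘ (cycleForms n)) ⟨
  sum (map (F ∘ toOneLine n) (cycleForms n))         ∎
  where open ≡-Reasoning

-- P gets the derangement test as a separate argument because `isDerangement` looks at the one-line word.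
sum-filter-permutations : ∀ n (P : Bool → Cycles → Bool) (f : Cycles → ℕ) →
  sum (map (f ∘ cycleForm n) (filterᵇ (λ π → P (isDerangement n π) (cycleForm n π)) (permutations n)))
  ≡ sum (map (λ C → if P (derangedCycles C) C then f C else 0) (cycleForms n))
sum-filter-permutations n P f = begin
  sum (map (f ∘ cycleForm n) (filterᵇ (λ π → P (isDerangement n π) (cycleForm n π)) (permutations n)))
    ≡⟨ sum-map-filterᵇ _ (f ∘ cycleForm n) (permutations n) ⟩
  sum (map term (permutations n))
    ≡⟨ sum-permutations n term ⟩
  sum (map (term ∘ toOneLine n) (cycleForms n))
    ≡⟨ sum-map-cong-local _ _ (read-back ∘ ∈cycleForms⇒IsCycleForm n) ⟩
  sum (map (λ C → if P (derangedCycles C) C then f C else 0) (cycleForms n))  ∎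
  where
  open ≡-Reasoning
  term : List ℕ → ℕ
  term π = if P (isDerangement n π) (cycleForm n π) then f (cycleForm n π) else 0
  read-back : ∀ {C} → IsCycleForm n C → term (toOneLine n C) ≡ (if P (derangedCycles C) C then f C else 0)
  read-back C-form rewrite cycleForm-toOneLine C-form | isDerangement-toOneLine C-form = refl

avoids3-21 : Cycles → Bool
avoids3-21 C = not (contains3-21 (concat C))

inD3-21Form : Cycles → Bool
inD3-21Form C = derangedCycles C ∧ avoids3-21 C

weight : (Cycles → Bool) → ℕ → Cycles → ℕ
weight P y C = if P C then y ^ length C else 0

rForm : ℕ → ℕ → Cycles → Bool
rForm i j C = inD3-21Form C ∧ (firstIs i (lastOf C) ∧ lastIs j (lastOf C))

sForm : ℕ → ℕ → Cycles → Bool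
sForm i j C = inD3-21Form C ∧ ((firstIs i (lastOf C) ∧ lastIs j (lastOf C)) ∧ (3 ≤ᵇ length (lastOf C)))

r≡sum-cycleForms : ∀ n i j y → r n i j y ≡ sum (map (weight (rForm i j) y) (cycleForms n))
r≡sum-cycleForms n i j y =
  sum-filter-permutations n (λ d C → (d ∧ avoids3-21 C) ∧ (firstIs i (lastOf C) ∧ lastIs j (lastOf C))) (λ C → y ^ length C)

s≡sum-cycleForms : ∀ n i j y → s n i j y ≡ sum (map (weight (sForm i j) y) (cycleForms n))
s≡sum-cycleForms n i j y = sum-filter-permutations n
  (λ d C → (d ∧ avoids3-21 C) ∧ (firstIs i (lastOf C) ∧ lastIs j (lastOf C)) ∧ (3 ≤ᵇ length (lastOf C))) (λ C → y ^ length C)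

punchIn : ℕ → ℕ → ℕ
punchIn j x = if x <ᵇ j then x else suc x

punchOut : ℕ → ℕ → ℕ
punchOut j x = if j <ᵇ x then pred x else x

module _ {j x : ℕ} where

  punchIn-< : x < j → punchIn j x ≡ x
  punchIn-< x<j rewrite <⇒<ᵇ-true x<j = refl

  punchIn-≥ : j ≤ x → punchIn j x ≡ suc x
  punchIn-≥ j≤x rewrite ≮⇒<ᵇ-false (≤⇒≯ j≤x) = refl

  punchOut-≤ : x ≤ j → punchOut j x ≡ x
  punchOut-≤ x≤j rewrite ≮⇒<ᵇ-false (≤⇒≯ x≤j) = refl

  punchOut-> : j ≤ x → punchOut j (suc x) ≡ x
  punchOut-> j≤x rewrite <⇒<ᵇ-true (s≤s j≤x) = refl

punchOut-punchIn : ∀ j x → punchOut j (punchIn j x) ≡ x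
punchOut-punchIn j x with x <? j
... | yes x<j rewrite punchIn-< x<j = punchOut-≤ (<⇒≤ x<j)
... | no  x≮j rewrite punchIn-≥ (≮⇒≥ x≮j) = punchOut-> (≮⇒≥ x≮j)

punchIn-punchOut : ∀ {j x} → x ≢ j → punchIn j (punchOut j x) ≡ x
punchIn-punchOut {j} {x} x≢j with <-cmp x j
... | tri< x<j _ _ rewrite punchOut-≤ (<⇒≤ x<j) = punchIn-< x<j
... | tri≈ _ x≡j _ = ⊥-elim (x≢j x≡j)
... | tri> _ _ (s≤s j≤x′) rewrite punchOut-> j≤x′ = punchIn-≥ j≤x′

punchIn≢ : ∀ j x → punchIn j x ≢ j
punchIn≢ j x with x <? j
... | yes x<j rewrite punchIn-< x<j = <⇒≢ x<j
... | no  x≮j rewrite punchIn-≥ (≮⇒≥ x≮j) = >⇒≢ (s≤s (≮⇒≥ x≮j))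

punchIn-injective : ∀ j {x y} → punchIn j x ≡ punchIn j y → x ≡ y
punchIn-injective j {x} {y} eq = trans (sym (punchOut-punchIn j x)) (trans (cong (punchOut j) eq) (punchOut-punchIn j y))

punchIn-mono-< : ∀ j {x y} → x < y → punchIn j x < punchIn j y
punchIn-mono-< j {x} {y} x<y with x <? j | y <? j
... | yes x<j | yes y<j rewrite punchIn-< x<j | punchIn-< y<j = x<y
... | yes x<j | no  y≮j rewrite punchIn-< x<j | punchIn-≥ (≮⇒≥ y≮j) = m<n⇒m<1+n x<y
... | no  x≮j | yes y<j = ⊥-elim (x≮j (<-trans x<y y<j))
... | no  x≮j | no  y≮j rewrite punchIn-≥ (≮⇒≥ x≮j) | punchIn-≥ (≮⇒≥ y≮j) = s≤s x<y

punchOut-mono-< : ∀ j {x y} → x ≢ j → y ≢ j → x < y → punchOut j x < punchOut j y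
punchOut-mono-< j {x} {y} x≢j y≢j x<y with <-cmp (punchOut j x) (punchOut j y)
... | tri< lt _ _ = lt
... | tri≈ _ eq _ = ⊥-elim (<⇒≢ x<y (begin
  x                         ≡⟨ punchIn-punchOut x≢j ⟨
  punchIn j (punchOut j x)  ≡⟨ cong (punchIn j) eq ⟩
  punchIn j (punchOut j y)  ≡⟨ punchIn-punchOut y≢j ⟩
  y                         ∎))
  where open ≡-Reasoning
... | tri> _ _ gt = ⊥-elim (<-asym x<y (subst₂ _<_ (punchIn-punchOut y≢j) (punchIn-punchOut x≢j) (punchIn-mono-< j gt)))

punchIn-∈[1‥] : ∀ {m} j {x} → x ∈ [1‥ m ] → punchIn j x ∈ [1‥ suc m ]
punchIn-∈[1‥] j {x} x∈ with (1≤x , x≤m) ← ∈[1‥]⁻ x∈ | x <? j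
... | yes x<j rewrite punchIn-< x<j = ∈[1‥]⁺ 1≤x (m≤n⇒m≤1+n x≤m)
... | no  x≮j rewrite punchIn-≥ (≮⇒≥ x≮j) = ∈[1‥]⁺ (s≤s z≤n) (s≤s x≤m)

punchOut-∈[1‥] : ∀ {m j x} → 1 ≤ j → j ≤ suc m → x ∈ [1‥ suc m ] → x ≢ j → punchOut j x ∈ [1‥ m ]
punchOut-∈[1‥] {m} {j} {x} 1≤j j≤1+m x∈ x≢j with (1≤x , x≤1+m) ← ∈[1‥]⁻ x∈ | <-cmp x j
... | tri< x<j _ _ rewrite punchOut-≤ (<⇒≤ x<j) = ∈[1‥]⁺ 1≤x (≤-pred (<-≤-trans x<j j≤1+m))
... | tri≈ _ x≡j _ = ⊥-elim (x≢j x≡j)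
... | tri> _ _ (s≤s j≤x′) rewrite punchOut-> j≤x′ = ∈[1‥]⁺ (≤-trans 1≤j j≤x′) (≤-pred x≤1+m)

relabel : (ℕ → ℕ) → Cycles → Cycles
relabel f = map (map f)

concat-relabel : ∀ f C → concat (relabel f C) ≡ map f (concat C)
concat-relabel f []      = refl
concat-relabel f (c ∷ C) = trans (cong (map f c ++_) (concat-relabel f C)) (sym (map-++ f c (concat C)))

relabel-∘ : ∀ f g C → relabel f (relabel g C) ≡ relabel (f ∘ g) C
relabel-∘ f g C = trans (sym (map-∘ C)) (map-cong (λ c → sym (map-∘ c)) C)

relabel-id-local : ∀ f C → (∀ {x} → x ∈ concat C → f x ≡ x) → relabel f C ≡ C
relabel-id-local f C f≡ =
  map-id-local (All.tabulate λ c∈ → map-id-local (All.tabulate λ x∈ → f≡ (∈-concat⁺′ x∈ c∈)))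

relabel-∷ʳ : ∀ f C c → relabel f (C ∷ʳ c) ≡ relabel f C ∷ʳ map f c
relabel-∷ʳ f C c = map-++ (map f) C [ c ]

derangedCycles-relabel : ∀ f C → derangedCycles (relabel f C) ≡ derangedCycles C
derangedCycles-relabel f []      = refl
derangedCycles-relabel f (c ∷ C) rewrite length-map f c = cong (_ ∧_) (derangedCycles-relabel f C)

Standard-relabel : ∀ f C → (∀ {x y} → x ∈ concat C → y ∈ concat C → x < y → f x < f y) →
                   Standard C → Standard (relabel f C)
Standard-relabel f []            _    []                 = []
Standard-relabel f ((h ∷ t) ∷ C) mono (cons h<t h<C C-std) =
  cons (All.map⁺ (All.tabulate λ x∈ → mono (here refl) (there (∈-++⁺ˡ x∈)) (All.lookup h<t x∈)))
       (All.map⁺ (All.tabulate λ c∈ → All.map⁺ (All.tabulate λ x∈ → mono (here refl) (∈-++⁺ʳ (h ∷ t) (∈-concat⁺′ x∈ c∈))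
                                                                         (All.lookup (All.lookup h<C c∈) x∈))))
       (Standard-relabel f C (λ x∈ y∈ → mono (∈-++⁺ʳ (h ∷ t) x∈) (∈-++⁺ʳ (h ∷ t) y∈)) C-std)

module _ {m j : ℕ} (1≤j : 1 ≤ j) (j≤1+m : j ≤ suc m) where

  IsCycleForm-punchOut : ∀ {C D W} → IsCycleForm (suc m) C → concat C ≡ W ∷ʳ j → concat D ≡ W → Standard D →
                         IsCycleForm m (relabel (punchOut j) D)
  IsCycleForm-punchOut {C} {D} {W} C-form C≡ D≡ D-std = record
    { standard = Standard-relabel (punchOut j) D (λ x∈ y∈ → punchOut-mono-< j (≢j x∈) (≢j y∈)) D-std
    ; unique   = subst Unique (sym (concat-relabel (punchOut j) D))
                   (Unique-map⁺ (punchOut j) punchOut-injective (subst Unique (sym D≡) (Unique-++⁻ˡ W W∷ʳj!)))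
    ; sound    = λ x∈ → let (y , y∈ , x≡) = ∈-map⁻ (punchOut j) (subst (_ ∈_) (concat-relabel (punchOut j) D) x∈)
                        in subst (_∈ [1‥ m ]) (sym x≡) (punchOut-∈[1‥] 1≤j j≤1+m (sound C-form (D⊆C y∈)) (≢j y∈))
    ; complete = complete′
    }
    where
    W∷ʳj! : Unique (W ∷ʳ j)
    W∷ʳj! = subst Unique C≡ (unique C-form)
    ≢j : ∀ {x} → x ∈ concat D → x ≢ j
    ≢j x∈ refl = Unique-∷ʳ⇒∉ W∷ʳj! (subst (_ ∈_) D≡ x∈)
    D⊆C : ∀ {x} → x ∈ concat D → x ∈ concat C
    D⊆C x∈ = subst (_ ∈_) (sym C≡) (∈-++⁺ˡ (subst (_ ∈_) D≡ x∈))
    punchOut-injective : ∀ {x y} → x ∈ concat D → y ∈ concat D → punchOut j x ≡ punchOut j y → x ≡ y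
    punchOut-injective x∈ y∈ eq =
      trans (sym (punchIn-punchOut (≢j x∈))) (trans (cong (punchIn j) eq) (punchIn-punchOut (≢j y∈)))
    complete′ : ∀ {x} → x ∈ [1‥ m ] → x ∈ concat (relabel (punchOut j) D)
    complete′ {x} x∈ with ∈-++⁻ W (subst (_ ∈_) C≡ (complete C-form (punchIn-∈[1‥] j x∈)))
    ... | inj₂ (here eq) = ⊥-elim (punchIn≢ j x eq)
    ... | inj₁ y∈W = subst (_ ∈_) (sym (concat-relabel (punchOut j) D))
                       (subst (_∈ _) (punchOut-punchIn j x) (∈-map⁺ (punchOut j) (subst (_ ∈_) (sym D≡) y∈W)))

  IsCycleForm-punchIn : ∀ {C D} → IsCycleForm m C → Standard D → concat D ≡ map (punchIn j) (concat C) ∷ʳ j →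
                        IsCycleForm (suc m) D
  IsCycleForm-punchIn {C} {D} C-form D-std D≡ = record
    { standard = D-std
    ; unique   = subst Unique (sym D≡)
                   (Unique-++⁺ (Unique-map⁺ (punchIn j) (λ _ _ → punchIn-injective j) (unique C-form)) (Unique-∷⁺ (λ ()) [])
                     λ { y∈ (here refl) → let (x , _ , eq) = ∈-map⁻ (punchIn j) y∈ in punchIn≢ j x (sym eq) })
    ; sound    = sound′
    ; complete = complete′
    }
    where
    sound′ : ∀ {y} → y ∈ concat D → y ∈ [1‥ suc m ]
    sound′ y∈ with ∈-++⁻ (map (punchIn j) (concat C)) (subst (_ ∈_) D≡ y∈)
    ... | inj₁ y∈map with x , x∈ , refl ← ∈-map⁻ (punchIn j) y∈map = punchIn-∈[1‥] j (sound C-form x∈)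
    ... | inj₂ (here refl) = ∈[1‥]⁺ 1≤j j≤1+m
    complete′ : ∀ {y} → y ∈ [1‥ suc m ] → y ∈ concat D
    complete′ {y} y∈ with y ≟ j
    ... | yes refl = subst (_ ∈_) (sym D≡) (∈-++⁺ʳ _ (here refl))
    ... | no  y≢j  = subst (_ ∈_) (sym D≡) (∈-++⁺ˡ (subst (_∈ _) (punchIn-punchOut y≢j)
                       (∈-map⁺ (punchIn j) (complete C-form (punchOut-∈[1‥] 1≤j j≤1+m y∈ y≢j)))))

adjBelow-∷ʳ-∷ʳ : ∀ x W a b → adjBelow x (W ++ a ∷ b ∷ []) ≡ adjBelow x (W ∷ʳ a) ∨ ((b <ᵇ a) ∧ (a <ᵇ x))
adjBelow-∷ʳ-∷ʳ x []           a b = ∨-identityʳ _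
adjBelow-∷ʳ-∷ʳ x (w ∷ [])     a b =
  trans (cong (((a <ᵇ w) ∧ (w <ᵇ x)) ∨_) (∨-identityʳ ((b <ᵇ a) ∧ (a <ᵇ x))))
        (sym (∨-assoc ((a <ᵇ w) ∧ (w <ᵇ x)) false ((b <ᵇ a) ∧ (a <ᵇ x))))
adjBelow-∷ʳ-∷ʳ x (w ∷ w′ ∷ W) a b =
  trans (cong (((w′ <ᵇ w) ∧ (w <ᵇ x)) ∨_) (adjBelow-∷ʳ-∷ʳ x (w′ ∷ W) a b))
        (sym (∨-assoc ((w′ <ᵇ w) ∧ (w <ᵇ x)) (adjBelow x (w′ ∷ W ∷ʳ a)) ((b <ᵇ a) ∧ (a <ᵇ x))))

contains3-21-∷ʳ-∷ʳ : ∀ W a b →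
  contains3-21 (W ++ a ∷ b ∷ []) ≡ contains3-21 (W ∷ʳ a) ∨ ((b <ᵇ a) ∧ any (a <ᵇ_) W)
contains3-21-∷ʳ-∷ʳ []      a b = sym (∧-zeroʳ _)
contains3-21-∷ʳ-∷ʳ (w ∷ W) a b = begin
  adjBelow w (W ++ a ∷ b ∷ []) ∨ contains3-21 (W ++ a ∷ b ∷ [])
    ≡⟨ cong₂ _∨_ (adjBelow-∷ʳ-∷ʳ w W a b) (contains3-21-∷ʳ-∷ʳ W a b) ⟩
  (adjBelow w (W ∷ʳ a) ∨ ((b <ᵇ a) ∧ (a <ᵇ w))) ∨ (contains3-21 (W ∷ʳ a) ∨ ((b <ᵇ a) ∧ any (a <ᵇ_) W))
    ≡⟨ regroup (adjBelow w (W ∷ʳ a)) (contains3-21 (W ∷ʳ a)) (b <ᵇ a) (a <ᵇ w) (any (a <ᵇ_) W) ⟩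
  (adjBelow w (W ∷ʳ a) ∨ contains3-21 (W ∷ʳ a)) ∨ ((b <ᵇ a) ∧ ((a <ᵇ w) ∨ any (a <ᵇ_) W))  ∎
  where
  open ≡-Reasoning
  open ∨-∧-Solver
  regroup : ∀ A B X P Q → (A ∨ (X ∧ P)) ∨ (B ∨ (X ∧ Q)) ≡ (A ∨ B) ∨ (X ∧ (P ∨ Q))
  regroup = solve 5 (λ A B X P Q → (A :+ (X :* P)) :+ (B :+ (X :* Q)) := (A :+ B) :+ (X :* (P :+ Q))) refl

module _ (f : ℕ → ℕ) where

  private
    <ᵇ-Preserved : List ℕ → Set
    <ᵇ-Preserved W = ∀ {x y} → x ∈ W → y ∈ W → (f x <ᵇ f y) ≡ (x <ᵇ y)

    adjBelow-map : ∀ x W → <ᵇ-Preserved (x ∷ W) → adjBelow (f x) (map f W) ≡ adjBelow x W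
    adjBelow-map x []           _   = refl
    adjBelow-map x (a ∷ [])     _   = refl
    adjBelow-map x (a ∷ b ∷ W) pres =
      cong₂ _∨_ (cong₂ _∧_ (pres (there (there (here refl))) (there (here refl))) (pres (there (here refl)) (here refl)))
                (adjBelow-map x (b ∷ W) λ u∈ v∈ → pres (skip u∈) (skip v∈))
      where
      skip : ∀ {u} → u ∈ x ∷ b ∷ W → u ∈ x ∷ a ∷ b ∷ W
      skip (here eq) = here eq
      skip (there u∈) = there (there u∈)

    contains3-21-map′ : ∀ W → <ᵇ-Preserved W → contains3-21 (map f W) ≡ contains3-21 W
    contains3-21-map′ []      _    = refl
    contains3-21-map′ (x ∷ W) pres =
      cong₂ _∨_ (adjBelow-map x W pres) (contains3-21-map′ W λ u∈ v∈ → pres (there u∈) (there v∈))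

  contains3-21-map : ∀ W → (∀ {x y} → x ∈ W → y ∈ W → x < y → f x < f y) → contains3-21 (map f W) ≡ contains3-21 W
  contains3-21-map W mono = contains3-21-map′ W pres
    where
    pres : <ᵇ-Preserved W
    pres {x} {y} x∈ y∈ with <-cmp x y
    ... | tri< x<y _ _ = trans (<⇒<ᵇ-true (mono x∈ y∈ x<y)) (sym (<⇒<ᵇ-true x<y))
    ... | tri≈ _ refl _ = trans (≮⇒<ᵇ-false {f x} {f x} (<-irrefl refl)) (sym (≮⇒<ᵇ-false {x} {x} (<-irrefl refl)))
    ... | tri> _ _ y<x = trans (≮⇒<ᵇ-false (<⇒≯ (mono y∈ x∈ y<x))) (sym (≮⇒<ᵇ-false (<⇒≯ y<x)))

inD3-21Form-relabel : ∀ f C → (∀ {x y} → x ∈ concat C → y ∈ concat C → x < y → f x < f y) →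
                   inD3-21Form (relabel f C) ≡ inD3-21Form C
inD3-21Form-relabel f C mono = cong₂ _∧_ (derangedCycles-relabel f C)
  (cong not (trans (cong contains3-21 (concat-relabel f C)) (contains3-21-map f (concat C) mono)))

lastOf-∷ʳ : ∀ (C : Cycles) c → lastOf (C ∷ʳ c) ≡ c
lastOf-∷ʳ []          c = refl
lastOf-∷ʳ (d ∷ [])     c = refl
lastOf-∷ʳ (d ∷ d′ ∷ C) c = lastOf-∷ʳ (d′ ∷ C) c

lastIs-∷ʳ : ∀ j u k → lastIs j (u ∷ʳ k) ≡ (j ≡ᵇ k)
lastIs-∷ʳ j []           k = refl
lastIs-∷ʳ j (x ∷ [])     k = refl
lastIs-∷ʳ j (x ∷ x′ ∷ u) k = lastIs-∷ʳ j (x′ ∷ u) k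

dropLast : {A : Set} → List A → List A
dropLast []           = []
dropLast (x ∷ [])     = []
dropLast (x ∷ y ∷ xs) = x ∷ dropLast (y ∷ xs)

dropLast-∷ʳ : {A : Set} (u : List A) (x : A) → dropLast (u ∷ʳ x) ≡ u
dropLast-∷ʳ []          x = refl
dropLast-∷ʳ (a ∷ [])    x = refl
dropLast-∷ʳ (a ∷ b ∷ u) x = cong (a ∷_) (dropLast-∷ʳ (b ∷ u) x)

firstEntry : List ℕ → ℕ
firstEntry []      = 0
firstEntry (x ∷ _) = x

lastEntry : List ℕ → ℕ
lastEntry []           = 0
lastEntry (x ∷ [])     = x
lastEntry (x ∷ y ∷ xs) = lastEntry (y ∷ xs)

lastEntry-∷ʳ : ∀ u x → lastEntry (u ∷ʳ x) ≡ x
lastEntry-∷ʳ []          x = refl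
lastEntry-∷ʳ (a ∷ [])    x = refl
lastEntry-∷ʳ (a ∷ b ∷ u) x = lastEntry-∷ʳ (b ∷ u) x

mapLast : (List ℕ → List ℕ) → Cycles → Cycles
mapLast f []          = []
mapLast f (c ∷ [])    = f c ∷ []
mapLast f (c ∷ d ∷ C) = c ∷ mapLast f (d ∷ C)

mapLast-∷ʳ : ∀ f D c → mapLast f (D ∷ʳ c) ≡ D ∷ʳ f c
mapLast-∷ʳ f []           c = refl
mapLast-∷ʳ f (d ∷ [])     c = refl
mapLast-∷ʳ f (d ∷ d′ ∷ D) c = cong (d ∷_) (mapLast-∷ʳ f (d′ ∷ D) c)

mergeLast : Cycles → Cycles
mergeLast C = mapLast (_∷ʳ firstEntry (lastOf C)) (dropLast C)

mergeLast-∷ʳ : ∀ D c i r → mergeLast (D ∷ʳ c ∷ʳ (i ∷ r)) ≡ D ∷ʳ (c ∷ʳ i)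
mergeLast-∷ʳ D c i r rewrite lastOf-∷ʳ (D ∷ʳ c) (i ∷ r) | dropLast-∷ʳ (D ∷ʳ c) (i ∷ r) = mapLast-∷ʳ (_∷ʳ i) D c

splitLast : ℕ → Cycles → Cycles
splitLast j C = mapLast dropLast C ∷ʳ (lastEntry (lastOf C) ∷ j ∷ [])

splitLast-∷ʳ : ∀ j D u i → splitLast j (D ∷ʳ (u ∷ʳ i)) ≡ D ∷ʳ u ∷ʳ (i ∷ j ∷ [])
splitLast-∷ʳ j D u i
  rewrite lastOf-∷ʳ D (u ∷ʳ i) | lastEntry-∷ʳ u i | mapLast-∷ʳ dropLast D (u ∷ʳ i) | dropLast-∷ʳ u i = refl

Standard-last : ∀ D {h t} → Standard (D ∷ʳ (h ∷ t)) → All (h <_) t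
Standard-last []      (cons h<t _ _)   = h<t
Standard-last (_ ∷ D) (cons _ _ D-std) = Standard-last D D-std

Standard-replaceLast : ∀ D {h t t′} → Standard (D ∷ʳ (h ∷ t)) → All (h <_) t′ → Standard (D ∷ʳ (h ∷ t′))
Standard-replaceLast []            _                   h<t′ = cons h<t′ [] []
Standard-replaceLast ((g ∷ s) ∷ D) (cons g<s g<D D-std) h<t′ =
  cons g<s (All.++⁺ (All.++⁻ˡ D g<D) (g<last (All.++⁻ʳ D g<D) ∷ [])) (Standard-replaceLast D D-std h<t′)
  where
  g<last : All (All (g <_)) [ _ ∷ _ ] → All (g <_) (_ ∷ _)
  g<last ((g<h ∷ _) ∷ []) = g<h ∷ All.map (<-trans g<h) h<t′

Standard-∷ʳ-cycle : ∀ D {h t i r} → Standard (D ∷ʳ (h ∷ t)) → h < i → All (i <_) r →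
                    Standard (D ∷ʳ (h ∷ t) ∷ʳ (i ∷ r))
Standard-∷ʳ-cycle []            (cons h<t [] []) h<i i<r = cons h<t ((h<i ∷ All.map (<-trans h<i) i<r) ∷ []) (cons i<r [] [])
Standard-∷ʳ-cycle ((g ∷ s) ∷ D) (cons g<s g<D D-std) h<i i<r =
  cons g<s (All.++⁺ g<D (g<new (All.++⁻ʳ D g<D) ∷ [])) (Standard-∷ʳ-cycle D D-std h<i i<r)
  where
  g<new : All (All (g <_)) [ _ ∷ _ ] → All (g <_) (_ ∷ _)
  g<new ((g<h ∷ _) ∷ []) = <-trans g<h h<i ∷ All.map (<-trans (<-trans g<h h<i)) i<r

Standard-∷ʳ-∷ʳ⁻ : ∀ D {h t i r} → Standard (D ∷ʳ (h ∷ t) ∷ʳ (i ∷ r)) → Standard (D ∷ʳ (h ∷ t)) × h < i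
Standard-∷ʳ-∷ʳ⁻ []            (cons h<t ((h<i ∷ _) ∷ []) _) = cons h<t [] [] , h<i
Standard-∷ʳ-∷ʳ⁻ ((g ∷ s) ∷ D) (cons g<s g<D D-std) =
  let (std , h<i) = Standard-∷ʳ-∷ʳ⁻ D D-std in cons g<s (All.++⁻ˡ (D ∷ʳ _) g<D) std , h<i

derangedCycles-∷ʳ : ∀ D c → derangedCycles (D ∷ʳ c) ≡ derangedCycles D ∧ (2 ≤ᵇ length c)
derangedCycles-∷ʳ D c = trans (all-++ (λ c → 2 ≤ᵇ length c) D) (cong (derangedCycles D ∧_) (∧-identityʳ _))

derangedCycles-∷ʳ⁻ : ∀ D c → derangedCycles (D ∷ʳ c) ≡ true → derangedCycles D ≡ true × 2 ≤ length c
derangedCycles-∷ʳ⁻ D c deranged =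
  let (D-deranged , c-long) = ∧-true⁻ {derangedCycles D} (trans (sym (derangedCycles-∷ʳ D c)) deranged)
  in D-deranged , ≤ᵇ⇒≤ 2 (length c) (Equivalence.from T-≡ c-long)

derangedCycles-∷ʳ⁺ : ∀ D c → derangedCycles D ≡ true → 2 ≤ length c → derangedCycles (D ∷ʳ c) ≡ true
derangedCycles-∷ʳ⁺ D c D-deranged 2≤ = trans (derangedCycles-∷ʳ D c) (cong₂ _∧_ D-deranged (≤⇒≤ᵇ-true 2≤))

inD3-21Form-∷ʳ⁻ : ∀ D c → inD3-21Form (D ∷ʳ c) ≡ true →
               (derangedCycles D ≡ true × 2 ≤ length c) × contains3-21 (concat (D ∷ʳ c)) ≡ false
inD3-21Form-∷ʳ⁻ D c inD≡ =
  let (deranged , avoids) = ∧-true⁻ {derangedCycles (D ∷ʳ c)} inD≡ in derangedCycles-∷ʳ⁻ D c deranged , not-injective avoids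

inD3-21Form-∷ʳ⁺ : ∀ D c → derangedCycles D ≡ true → 2 ≤ length c → contains3-21 (concat (D ∷ʳ c)) ≡ false →
               inD3-21Form (D ∷ʳ c) ≡ true
inD3-21Form-∷ʳ⁺ D c D-deranged 2≤ avoids = cong₂ _∧_ (derangedCycles-∷ʳ⁺ D c D-deranged 2≤) (cong not avoids)

lastIs-refl : ∀ j u → lastIs j (u ∷ʳ j) ≡ true
lastIs-refl j u = trans (lastIs-∷ʳ j u j) (≡ᵇ-refl j)

firstIs-lastIs⁻ : ∀ {i j c} → firstIs i c ≡ true → lastIs j c ≡ true → 2 ≤ length c → ∃ λ t → c ≡ i ∷ t ∷ʳ j
firstIs-lastIs⁻ {i} {j} {h ∷ t} first last 2≤ with initLast t
... | []        = ⊥-elim (<-irrefl refl 2≤)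
... | t′ ∷ʳ′ j′
  with refl ← ≡ᵇ-true⇒≡ {i} {h} first | refl ← ≡ᵇ-true⇒≡ {j} {j′} (trans (sym (lastIs-∷ʳ j (h ∷ t′) j′)) last) =
  t′ , refl

firstIs-unique : ∀ {k k′} L → firstIs k L ≡ true → firstIs k′ L ≡ true → k ≡ k′
firstIs-unique {k} {k′} (x ∷ _) k≡x k′≡x = trans (≡ᵇ-true⇒≡ {k} {x} k≡x) (sym (≡ᵇ-true⇒≡ {k′} {x} k′≡x))

lastIs-unique : ∀ {k k′} L → lastIs k L ≡ true → lastIs k′ L ≡ true → k ≡ k′
lastIs-unique {k} {k′} (x ∷ [])     k≡x k′≡x = trans (≡ᵇ-true⇒≡ {k} {x} k≡x) (sym (≡ᵇ-true⇒≡ {k′} {x} k′≡x))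
lastIs-unique         (_ ∷ y ∷ L) k≡  k′≡  = lastIs-unique (y ∷ L) k≡ k′≡

-- Removing the final entry of a long last cycle

dropLastEntry : ℕ → Cycles → Cycles
dropLastEntry j C = relabel (punchOut j) (mapLast dropLast C)

appendLastEntry : ℕ → Cycles → Cycles
appendLastEntry j C = mapLast (_∷ʳ j) (relabel (punchIn j) C)

longImage : ℕ → ℕ → ℕ → Cycles → Bool
longImage m i j C =
  inD3-21Form C ∧ (firstIs i (lastOf C) ∧ (any (λ k → lastIs k (lastOf C)) (range (i + 1) j) ∨ ((j <ᵇ suc m) ∧ lastIs m (lastOf C))))

last-above⇒maximum : ∀ {m C W k j} → IsCycleForm (suc m) C → concat C ≡ W ++ k ∷ j ∷ [] →
                     any (k <ᵇ_) W ≡ false → j < k → k ≡ suc m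
last-above⇒maximum {m} {C} {W} {k} {j} C-form C≡ none-above j<k = ≤-antisym k≤1+m 1+m≤k
  where
  k≤1+m : k ≤ suc m
  k≤1+m = proj₂ (∈[1‥]⁻ (sound C-form (subst (k ∈_) (sym C≡) (∈-++⁺ʳ W (here refl)))))
  1+m≤k : suc m ≤ k
  1+m≤k with ∈-++⁻ W (subst (suc m ∈_) C≡ (complete C-form 1+n∈[1‥1+n]))
  ... | inj₁ 1+m∈W              =
    ≮⇒≥ λ k<1+m → false≢true (trans (sym none-above) (any-true⁺ (k <ᵇ_) 1+m∈W (<⇒<ᵇ-true k<1+m)))
  ... | inj₂ (here refl)         = ≤-refl
  ... | inj₂ (there (here refl)) = ⊥-elim (<-irrefl refl (<-≤-trans j<k k≤1+m))

module LongCase {m i j : ℕ} (1≤i : 1 ≤ i) (i<j : i < j) (j≤1+m : j ≤ suc m) where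

  private
    1≤j : 1 ≤ j
    1≤j = ≤-trans 1≤i (<⇒≤ i<j)

  sForm-shape : ∀ C → sForm i j C ≡ true → ∃₂ λ D t → ∃ λ k → C ≡ D ∷ʳ ((i ∷ t ∷ʳ k) ∷ʳ j)
  sForm-shape C sForm≡ with initLast C
  ... | [] with () ← sForm≡
  ... | D ∷ʳ′ c
    with (ends , long) ← ∧-true⁻ {firstIs i c ∧ lastIs j c}
           (subst (λ L → (firstIs i L ∧ lastIs j L) ∧ (3 ≤ᵇ length L) ≡ true) (lastOf-∷ʳ D c)
                  (proj₂ (∧-true⁻ {inD3-21Form (D ∷ʳ c)} sForm≡)))
    with (first , last) ← ∧-true⁻ {firstIs i c} ends
    with u , refl ← firstIs-lastIs⁻ {i} {j} {c} first last
                      (≤-trans (s≤s (s≤s z≤n)) (≤ᵇ⇒≤ 3 (length c) (Equivalence.from T-≡ long)))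
    with initLast u
  ... | []       = ⊥-elim (false≢true long)
  ... | t ∷ʳ′ k = D , t , k , refl

  dropLastEntry-∷ʳ : ∀ D c → dropLastEntry j (D ∷ʳ (c ∷ʳ j)) ≡ relabel (punchOut j) (D ∷ʳ c)
  dropLastEntry-∷ʳ D c =
    cong (relabel (punchOut j)) (trans (mapLast-∷ʳ dropLast D (c ∷ʳ j)) (cong (D ∷ʳ_) (dropLast-∷ʳ c j)))

  appendLastEntry-∷ʳ : ∀ D c → appendLastEntry j (D ∷ʳ c) ≡ relabel (punchIn j) D ∷ʳ (map (punchIn j) c ∷ʳ j)
  appendLastEntry-∷ʳ D c =
    trans (cong (mapLast (_∷ʳ j)) (relabel-∷ʳ (punchIn j) D c)) (mapLast-∷ʳ (_∷ʳ j) (relabel (punchIn j) D) _)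

  module Forth (D : Cycles) (t : List ℕ) (k : ℕ) (C-form : IsCycleForm (suc m) (D ∷ʳ ((i ∷ t ∷ʳ k) ∷ʳ j)))
               (inD≡ : inD3-21Form (D ∷ʳ ((i ∷ t ∷ʳ k) ∷ʳ j)) ≡ true) where

    c : List ℕ
    c = i ∷ t ∷ʳ k

    W : List ℕ
    W = concat D ++ i ∷ t

    E : Cycles
    E = relabel (punchOut j) (D ∷ʳ c)

    L : List ℕ
    L = lastOf E

    concat-C′ : concat (D ∷ʳ c) ≡ W ∷ʳ k
    concat-C′ = trans (concat-∷ʳ D c) (sym (++-assoc (concat D) (i ∷ t) [ k ]))

    concat-C : concat (D ∷ʳ (c ∷ʳ j)) ≡ W ∷ʳ k ∷ʳ j
    concat-C = begin
      concat (D ∷ʳ (c ∷ʳ j))    ≡⟨ concat-∷ʳ D (c ∷ʳ j) ⟩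
      concat D ++ (c ∷ʳ j)      ≡⟨ ++-assoc (concat D) c [ j ] ⟨
      (concat D ++ c) ∷ʳ j      ≡⟨ cong (_∷ʳ j) (concat-∷ʳ D c) ⟨
      concat (D ∷ʳ c) ∷ʳ j      ≡⟨ cong (_∷ʳ j) concat-C′ ⟩
      W ∷ʳ k ∷ʳ j               ∎
      where open ≡-Reasoning

    concat-C-kj : concat (D ∷ʳ (c ∷ʳ j)) ≡ W ++ k ∷ j ∷ []
    concat-C-kj = trans concat-C (++-assoc W [ k ] [ j ])

    ≢j : ∀ {x} → x ∈ concat (D ∷ʳ c) → x ≢ j
    ≢j x∈ refl = Unique-∷ʳ⇒∉ (subst Unique concat-C (unique C-form)) (subst (_ ∈_) concat-C′ x∈)

    E-form : IsCycleForm m E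
    E-form = IsCycleForm-punchOut 1≤j j≤1+m C-form concat-C concat-C′
      (Standard-replaceLast D (standard C-form) (All.++⁻ˡ (t ∷ʳ k) (Standard-last D (standard C-form))))

    private
      avoids-split : contains3-21 (W ∷ʳ k) ≡ false × ((j <ᵇ k) ∧ any (k <ᵇ_) W) ≡ false
      avoids-split = ∨-false⁻ (begin
        contains3-21 (W ∷ʳ k) ∨ ((j <ᵇ k) ∧ any (k <ᵇ_) W) ≡⟨ contains3-21-∷ʳ-∷ʳ W k j ⟨
        contains3-21 (W ++ k ∷ j ∷ [])                      ≡⟨ cong contains3-21 concat-C-kj ⟨
        contains3-21 (concat (D ∷ʳ (c ∷ʳ j)))               ≡⟨ proj₂ (inD3-21Form-∷ʳ⁻ D (c ∷ʳ j) inD≡) ⟩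
        false                                               ∎)
        where open ≡-Reasoning

    inD-E : inD3-21Form E ≡ true
    inD-E = trans (inD3-21Form-relabel (punchOut j) (D ∷ʳ c) λ x∈ y∈ → punchOut-mono-< j (≢j x∈) (≢j y∈))
      (inD3-21Form-∷ʳ⁺ D c (proj₁ (proj₁ (inD3-21Form-∷ʳ⁻ D (c ∷ʳ j) inD≡)))
                    (s≤s (subst (1 ≤_) (sym (length-∷ʳ t k)) (s≤s z≤n)))
                    (trans (cong contains3-21 concat-C′) (proj₁ avoids-split)))

    L≡ : L ≡ i ∷ map (punchOut j) t ∷ʳ punchOut j k
    L≡ = trans (cong lastOf (relabel-∷ʳ (punchOut j) D c))
      (trans (lastOf-∷ʳ (relabel (punchOut j) D) (map (punchOut j) c))
             (cong₂ _∷_ (punchOut-≤ (<⇒≤ i<j)) (map-++ (punchOut j) t [ k ])))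

    private
      i<k : i < k
      i<k = All.lookup (Standard-last D (standard C-form)) (∈-++⁺ˡ (∈-++⁺ʳ t (here refl)))

      lastIs-L : ∀ x → lastIs x L ≡ (x ≡ᵇ punchOut j k)
      lastIs-L x = trans (cong (lastIs x) L≡) (lastIs-∷ʳ x (i ∷ map (punchOut j) t) (punchOut j k))

    endpoint : any (λ x → lastIs x L) (range (i + 1) j) ∨ ((j <ᵇ suc m) ∧ lastIs m L) ≡ true
    endpoint with <-cmp k j
    ... | tri< k<j _ _ = cong (_∨ ((j <ᵇ suc m) ∧ lastIs m L))
      (any-true⁺ (λ x → lastIs x L) (∈-range⁺ (subst (_≤ k) (+-comm 1 i) i<k) k<j)
                 (trans (lastIs-L k) (trans (cong (k ≡ᵇ_) (punchOut-≤ (<⇒≤ k<j))) (≡ᵇ-refl k))))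
    ... | tri≈ _ k≡j _ = ⊥-elim (≢j (subst (k ∈_) (sym concat-C′) (∈-++⁺ʳ W (here refl))) k≡j)
    ... | tri> _ _ j<k with refl ← last-above⇒maximum C-form concat-C-kj
                                    (subst (λ b → b ∧ any (k <ᵇ_) W ≡ false) (<⇒<ᵇ-true j<k) (proj₂ avoids-split)) j<k =
      trans (cong (any (λ x → lastIs x L) (range (i + 1) j) ∨_)
                  (cong₂ _∧_ (<⇒<ᵇ-true j<k) (trans (lastIs-L m) (trans (cong (m ≡ᵇ_) (punchOut-> (≤-pred j<k))) (≡ᵇ-refl m)))))
            (∨-zeroʳ (any (λ x → lastIs x L) (range (i + 1) j)))

    image : longImage m i j E ≡ true
    image = cong₂ _∧_ inD-E (cong₂ _∧_ (trans (cong (firstIs i) L≡) (≡ᵇ-refl i)) endpoint)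

    inverse : appendLastEntry j E ≡ D ∷ʳ (c ∷ʳ j)
    inverse = trans (cong (mapLast (_∷ʳ j)) (trans (relabel-∘ (punchIn j) (punchOut j) (D ∷ʳ c))
                                                   (relabel-id-local _ (D ∷ʳ c) (punchIn-punchOut ∘ ≢j))))
                    (mapLast-∷ʳ (_∷ʳ j) D c)

  forth : ∀ {C} → IsCycleForm (suc m) C → sForm i j C ≡ true →
    (IsCycleForm m (dropLastEntry j C) × longImage m i j (dropLastEntry j C) ≡ true) ×
    (appendLastEntry j (dropLastEntry j C) ≡ C × length (dropLastEntry j C) ≡ length C)
  forth {C} C-form sForm≡ with D , t , k , refl ← sForm-shape C sForm≡ rewrite dropLastEntry-∷ʳ D (i ∷ t ∷ʳ k) =
    (E-form , image) , (inverse , trans (length-map _ (D ∷ʳ c)) (trans (length-∷ʳ D c) (sym (length-∷ʳ D (c ∷ʳ j)))))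
    where open Forth D t k C-form (proj₁ (∧-true⁻ {inD3-21Form C} sForm≡))

  longImage-shape : ∀ E → longImage m i j E ≡ true → ∃₂ λ D t → ∃ λ k → E ≡ D ∷ʳ (i ∷ t ∷ʳ k)
  longImage-shape E image≡ with initLast E
  ... | [] with () ← image≡
  ... | D ∷ʳ′ c
    with (inD≡ , ends) ← ∧-true⁻ {inD3-21Form (D ∷ʳ c)} image≡
    with first ← subst (λ L → firstIs i L ≡ true) (lastOf-∷ʳ D c) (proj₁ (∧-true⁻ {firstIs i (lastOf (D ∷ʳ c))} ends))
    with 2≤|c| ← proj₂ (proj₁ (inD3-21Form-∷ʳ⁻ D c inD≡))
    with c
  ... | []    with () ← first
  ... | h ∷ u with refl ← ≡ᵇ-true⇒≡ {i} {h} first with initLast u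
  ...   | []       = ⊥-elim (<-irrefl refl 2≤|c|)
  ...   | t ∷ʳ′ k = D , t , k , refl

  module Back (D : Cycles) (t : List ℕ) (k : ℕ) (E-form : IsCycleForm m (D ∷ʳ (i ∷ t ∷ʳ k)))
              (image≡ : longImage m i j (D ∷ʳ (i ∷ t ∷ʳ k)) ≡ true) where

    c : List ℕ
    c = i ∷ t ∷ʳ k

    D⁺ : Cycles
    D⁺ = relabel (punchIn j) D

    c⁺ : List ℕ
    c⁺ = i ∷ map (punchIn j) t ∷ʳ punchIn j k

    map-punchIn-c : map (punchIn j) c ≡ c⁺
    map-punchIn-c = cong₂ _∷_ (punchIn-< i<j) (map-++ (punchIn j) t [ k ])

    relabel-E : relabel (punchIn j) (D ∷ʳ c) ≡ D⁺ ∷ʳ c⁺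
    relabel-E = trans (relabel-∷ʳ (punchIn j) D c) (cong (D⁺ ∷ʳ_) map-punchIn-c)

    X : Cycles
    X = D⁺ ∷ʳ (c⁺ ∷ʳ j)

    appendLastEntry≡X : appendLastEntry j (D ∷ʳ c) ≡ X
    appendLastEntry≡X = trans (appendLastEntry-∷ʳ D c) (cong (λ c′ → D⁺ ∷ʳ (c′ ∷ʳ j)) map-punchIn-c)

    V : List ℕ
    V = concat D⁺ ++ i ∷ map (punchIn j) t

    concat-E⁺ : map (punchIn j) (concat (D ∷ʳ c)) ≡ V ∷ʳ punchIn j k
    concat-E⁺ = begin
      map (punchIn j) (concat (D ∷ʳ c))      ≡⟨ concat-relabel (punchIn j) (D ∷ʳ c) ⟨
      concat (relabel (punchIn j) (D ∷ʳ c))  ≡⟨ cong concat relabel-E ⟩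
      concat (D⁺ ∷ʳ c⁺)                      ≡⟨ concat-∷ʳ D⁺ c⁺ ⟩
      concat D⁺ ++ c⁺                        ≡⟨ ++-assoc (concat D⁺) (i ∷ map (punchIn j) t) _ ⟨
      V ∷ʳ punchIn j k                       ∎
      where open ≡-Reasoning

    concat-X : concat X ≡ V ∷ʳ punchIn j k ∷ʳ j
    concat-X = begin
      concat X                       ≡⟨ concat-∷ʳ D⁺ (c⁺ ∷ʳ j) ⟩
      concat D⁺ ++ (c⁺ ∷ʳ j)         ≡⟨ ++-assoc (concat D⁺) c⁺ [ j ] ⟨
      (concat D⁺ ++ c⁺) ∷ʳ j         ≡⟨ cong (_∷ʳ j) (++-assoc (concat D⁺) (i ∷ map (punchIn j) t) _) ⟨
      V ∷ʳ punchIn j k ∷ʳ j          ∎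
      where open ≡-Reasoning

    X-form : IsCycleForm (suc m) X
    X-form = IsCycleForm-punchIn 1≤j j≤1+m E-form X-std (trans concat-X (cong (_∷ʳ j) (sym concat-E⁺)))
      where
      E⁺-std : Standard (D⁺ ∷ʳ c⁺)
      E⁺-std = subst Standard relabel-E (Standard-relabel (punchIn j) (D ∷ʳ c) (λ _ _ → punchIn-mono-< j) (standard E-form))
      X-std : Standard X
      X-std = Standard-replaceLast D⁺ E⁺-std (All.++⁺ (Standard-last D⁺ E⁺-std) (i<j ∷ []))

    inverse : dropLastEntry j X ≡ D ∷ʳ c
    inverse = begin
      dropLastEntry j X                                   ≡⟨ dropLastEntry-∷ʳ D⁺ c⁺ ⟩
      relabel (punchOut j) (D⁺ ∷ʳ c⁺)                     ≡⟨ cong (relabel (punchOut j)) relabel-E ⟨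
      relabel (punchOut j) (relabel (punchIn j) (D ∷ʳ c)) ≡⟨ relabel-∘ (punchOut j) (punchIn j) (D ∷ʳ c) ⟩
      relabel (punchOut j ∘ punchIn j) (D ∷ʳ c)           ≡⟨ relabel-id-local _ (D ∷ʳ c) (λ {x} _ → punchOut-punchIn j x) ⟩
      D ∷ʳ c                                              ∎
      where open ≡-Reasoning

    private
      inD-E : (derangedCycles D ≡ true × 2 ≤ length c) × contains3-21 (concat (D ∷ʳ c)) ≡ false
      inD-E = inD3-21Form-∷ʳ⁻ D c (proj₁ (∧-true⁻ {inD3-21Form (D ∷ʳ c)} image≡))

      endpoint-E : any (λ x → lastIs x c) (range (i + 1) j) ∨ ((j <ᵇ suc m) ∧ lastIs m c) ≡ true
      endpoint-E = subst (λ L → any (λ x → lastIs x L) (range (i + 1) j) ∨ ((j <ᵇ suc m) ∧ lastIs m L) ≡ true)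
        (lastOf-∷ʳ D c) (proj₂ (∧-true⁻ {firstIs i (lastOf (D ∷ʳ c))} (proj₂ (∧-true⁻ {inD3-21Form (D ∷ʳ c)} image≡))))

      lastIs-c : ∀ x → lastIs x c ≡ (x ≡ᵇ k)
      lastIs-c x = lastIs-∷ʳ x (i ∷ t) k

    no-descent-at-end : ((j <ᵇ punchIn j k) ∧ any (punchIn j k <ᵇ_) V) ≡ false
    no-descent-at-end with any (λ x → lastIs x c) (range (i + 1) j) in below
    ... | true with x , x∈ , lastIs-x ← any-true⁻ (λ x → lastIs x c) (range (i + 1) j) below
               with refl ← ≡ᵇ-true⇒≡ {x} {k} (trans (sym (lastIs-c x)) lastIs-x) =
      trans (cong (λ y → (j <ᵇ y) ∧ any (y <ᵇ_) V) (punchIn-< k<j)) (cong (_∧ any (k <ᵇ_) V) (≮⇒<ᵇ-false (<⇒≯ k<j)))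
      where
      k<j : k < j
      k<j = proj₂ (∈-range⁻ x∈)
    ... | false with (j<1+m , lastIs-m) ← ∧-true⁻ {j <ᵇ suc m}
                                             (trans (cong (_∨ ((j <ᵇ suc m) ∧ lastIs m c)) (sym below)) endpoint-E)
                with refl ← ≡ᵇ-true⇒≡ {m} {k} (trans (sym (lastIs-c m)) lastIs-m) =
      trans (cong (λ y → (j <ᵇ y) ∧ any (y <ᵇ_) V) (punchIn-≥ {j} {k} (≤-pred (<ᵇ-true⇒< {j} {suc k} j<1+m))))
            (trans (cong ((j <ᵇ suc k) ∧_) (any-false⁺ (suc k <ᵇ_) V λ v∈ → ≮⇒<ᵇ-false (≤⇒≯ (v≤1+m v∈)))) (∧-zeroʳ _))
      where
      v≤1+m : ∀ {v} → v ∈ V → v ≤ suc k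
      v≤1+m v∈ = proj₂ (∈[1‥]⁻ (sound X-form (subst (_ ∈_) (sym concat-X) (∈-++⁺ˡ (∈-++⁺ˡ v∈)))))

    sForm-X : sForm i j X ≡ true
    sForm-X rewrite lastOf-∷ʳ D⁺ (c⁺ ∷ʳ j) = cong₂ _∧_ inD-X
      (cong₂ _∧_ (cong₂ _∧_ (≡ᵇ-refl i) (lastIs-refl j c⁺)) (≤⇒≤ᵇ-true 3≤))
      where
      3≤ : 3 ≤ length (c⁺ ∷ʳ j)
      3≤ = subst (3 ≤_) (sym (trans (length-∷ʳ c⁺ j) (cong (suc ∘ suc) (length-∷ʳ (map (punchIn j) t) (punchIn j k)))))
                 (s≤s (s≤s (s≤s z≤n)))
      inD-X : inD3-21Form X ≡ true
      inD-X = inD3-21Form-∷ʳ⁺ D⁺ (c⁺ ∷ʳ j)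
        (trans (derangedCycles-relabel (punchIn j) D) (proj₁ (proj₁ inD-E))) (≤-trans (s≤s (s≤s z≤n)) 3≤) (begin
          contains3-21 (concat X)                    ≡⟨ cong contains3-21 (trans concat-X (++-assoc V _ [ j ])) ⟩
          contains3-21 (V ++ punchIn j k ∷ j ∷ [])   ≡⟨ contains3-21-∷ʳ-∷ʳ V (punchIn j k) j ⟩
          contains3-21 (V ∷ʳ punchIn j k) ∨ ((j <ᵇ punchIn j k) ∧ any (punchIn j k <ᵇ_) V)
                                                     ≡⟨ cong₂ _∨_ avoids-prefix no-descent-at-end ⟩
          false                                      ∎)
        where
        open ≡-Reasoning
        avoids-prefix : contains3-21 (V ∷ʳ punchIn j k) ≡ false
        avoids-prefix = begin
          contains3-21 (V ∷ʳ punchIn j k)                  ≡⟨ cong contains3-21 concat-E⁺ ⟨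
          contains3-21 (map (punchIn j) (concat (D ∷ʳ c))) ≡⟨ contains3-21-map (punchIn j) (concat (D ∷ʳ c)) (λ _ _ → punchIn-mono-< j) ⟩
          contains3-21 (concat (D ∷ʳ c))                   ≡⟨ proj₂ inD-E ⟩
          false                                            ∎

  back : ∀ {E} → IsCycleForm m E → longImage m i j E ≡ true →
    (IsCycleForm (suc m) (appendLastEntry j E) × sForm i j (appendLastEntry j E) ≡ true) ×
    dropLastEntry j (appendLastEntry j E) ≡ E
  back {E} E-form image≡ with D , t , k , refl ← longImage-shape E image≡
    rewrite Back.appendLastEntry≡X D t k E-form image≡ =
    (X-form , sForm-X) , inverse
    where
    open Back D t k E-form image≡

-- Merging a last cycle (i j) into its predecessor

mergeLastTwo : ℕ → Cycles → Cycles
mergeLastTwo j C = relabel (punchOut j) (mergeLast C)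

splitLastTwo : ℕ → Cycles → Cycles
splitLastTwo j C = splitLast j (relabel (punchIn j) C)

shortForm : ℕ → ℕ → Cycles → Bool
shortForm i j C = inD3-21Form C ∧ ((firstIs i (lastOf C) ∧ lastIs j (lastOf C)) ∧ not (3 ≤ᵇ length (lastOf C)))

shortImage : ℕ → Cycles → Bool
shortImage i C =
  inD3-21Form C ∧ ((any (λ ℓ → firstIs ℓ (lastOf C)) (range 1 i) ∧ lastIs i (lastOf C)) ∧ (3 ≤ᵇ length (lastOf C)))

module ShortCase {m i j : ℕ} (1≤i : 1 ≤ i) (i<j : i < j) (j≤1+m : j ≤ suc m) where

  private
    1≤j : 1 ≤ j
    1≤j = ≤-trans 1≤i (<⇒≤ i<j)

  shortForm-shape : ∀ C → 2 ≤ m → IsCycleForm (suc m) C → shortForm i j C ≡ true →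
                    ∃₂ λ D ℓ → ∃ λ t → 1 ≤ length t × C ≡ D ∷ʳ (ℓ ∷ t) ∷ʳ (i ∷ j ∷ [])
  shortForm-shape C 2≤m C-form shortForm≡ with initLast C
  ... | [] with () ← shortForm≡
  ... | D₀ ∷ʳ′ c
    with (inD≡ , ends) ← ∧-true⁻ {inD3-21Form (D₀ ∷ʳ c)} shortForm≡
    with ((D₀-deranged , 2≤|c|) , _) ← inD3-21Form-∷ʳ⁻ D₀ c inD≡
    with (first-last , short) ← ∧-true⁻ {firstIs i c ∧ lastIs j c}
           (subst (λ L → (firstIs i L ∧ lastIs j L) ∧ not (3 ≤ᵇ length L) ≡ true) (lastOf-∷ʳ D₀ c) ends)
    with (first , last) ← ∧-true⁻ {firstIs i c} first-last
    with u , refl ← firstIs-lastIs⁻ {i} {j} {c} first last 2≤|c|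
    with u
  ... | x ∷ w = ⊥-elim (false≢true (trans (sym (cong not (≤⇒≤ᵇ-true 3≤))) short))
    where
    3≤ : 3 ≤ length (i ∷ x ∷ w ∷ʳ j)
    3≤ = s≤s (s≤s (subst (1 ≤_) (sym (length-∷ʳ w j)) (s≤s z≤n)))
  ... | [] with initLast D₀
  ...   | [] = ⊥-elim (<⇒≱ (s≤s 2≤m) (subst (_≤ 2) (length-applyUpTo suc (suc m))
                                            (Unique-⊆⇒length≤ (Unique-[1‥] (suc m)) (complete C-form))))
  ...   | D ∷ʳ′ d with (_ , 2≤|d|) ← derangedCycles-∷ʳ⁻ D d D₀-deranged
                  with d
  ...     | []    with () ← 2≤|d|
  ...     | ℓ ∷ t = D , ℓ , t , ≤-pred 2≤|d| , refl

  mergeLastTwo-∷ʳ : ∀ D d → mergeLastTwo j (D ∷ʳ d ∷ʳ (i ∷ j ∷ [])) ≡ relabel (punchOut j) (D ∷ʳ (d ∷ʳ i))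
  mergeLastTwo-∷ʳ D d = cong (relabel (punchOut j)) (mergeLast-∷ʳ D d i [ j ])

  module Forth (D : Cycles) (ℓ : ℕ) (t : List ℕ) (1≤|t| : 1 ≤ length t)
               (C-form : IsCycleForm (suc m) (D ∷ʳ (ℓ ∷ t) ∷ʳ (i ∷ j ∷ [])))
               (inD≡ : inD3-21Form (D ∷ʳ (ℓ ∷ t) ∷ʳ (i ∷ j ∷ [])) ≡ true) where

    d′ : List ℕ
    d′ = ℓ ∷ t ∷ʳ i

    W : List ℕ
    W = concat D ++ ℓ ∷ t

    concat-C′ : concat (D ∷ʳ d′) ≡ W ∷ʳ i
    concat-C′ = trans (concat-∷ʳ D d′) (sym (++-assoc (concat D) (ℓ ∷ t) [ i ]))

    concat-C : concat (D ∷ʳ (ℓ ∷ t) ∷ʳ (i ∷ j ∷ [])) ≡ W ++ i ∷ j ∷ []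
    concat-C = begin
      concat (D ∷ʳ (ℓ ∷ t) ∷ʳ (i ∷ j ∷ []))   ≡⟨ concat-∷ʳ (D ∷ʳ (ℓ ∷ t)) (i ∷ j ∷ []) ⟩
      concat (D ∷ʳ (ℓ ∷ t)) ++ i ∷ j ∷ []     ≡⟨ cong (_++ i ∷ j ∷ []) (concat-∷ʳ D (ℓ ∷ t)) ⟩
      (concat D ++ ℓ ∷ t) ++ i ∷ j ∷ []       ∎
      where open ≡-Reasoning

    private
      concat-C∷ʳ : concat (D ∷ʳ (ℓ ∷ t) ∷ʳ (i ∷ j ∷ [])) ≡ (W ∷ʳ i) ∷ʳ j
      concat-C∷ʳ = trans concat-C (sym (++-assoc W [ i ] [ j ]))

      standard-split : Standard (D ∷ʳ (ℓ ∷ t)) × ℓ < i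
      standard-split = Standard-∷ʳ-∷ʳ⁻ D (standard C-form)

    ≢j : ∀ {x} → x ∈ concat (D ∷ʳ d′) → x ≢ j
    ≢j x∈ refl = Unique-∷ʳ⇒∉ (subst Unique concat-C∷ʳ (unique C-form)) (subst (_ ∈_) concat-C′ x∈)

    C′-form : IsCycleForm m (relabel (punchOut j) (D ∷ʳ d′))
    C′-form = IsCycleForm-punchOut 1≤j j≤1+m C-form concat-C∷ʳ concat-C′
      (Standard-replaceLast D (proj₁ standard-split)
        (All.++⁺ (Standard-last D (proj₁ standard-split)) (proj₂ standard-split ∷ [])))

    lastCycle-C′ : lastOf (relabel (punchOut j) (D ∷ʳ d′)) ≡ ℓ ∷ map (punchOut j) t ∷ʳ i
    lastCycle-C′ = trans (cong lastOf (relabel-∷ʳ (punchOut j) D d′))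
      (trans (lastOf-∷ʳ (relabel (punchOut j) D) (map (punchOut j) d′))
        (cong₂ _∷_ (punchOut-≤ (<⇒≤ (<-trans (proj₂ standard-split) i<j)))
                   (trans (map-++ (punchOut j) t [ i ]) (cong (map (punchOut j) t ∷ʳ_) (punchOut-≤ (<⇒≤ i<j))))))

    private
      inD-C : (derangedCycles (D ∷ʳ (ℓ ∷ t)) ≡ true × 2 ≤ 2) ×
              contains3-21 (concat (D ∷ʳ (ℓ ∷ t) ∷ʳ (i ∷ j ∷ []))) ≡ false
      inD-C = inD3-21Form-∷ʳ⁻ (D ∷ʳ (ℓ ∷ t)) (i ∷ j ∷ []) inD≡

      avoids-prefix : contains3-21 (W ∷ʳ i) ≡ false
      avoids-prefix = proj₁ (∨-false⁻ (begin
        contains3-21 (W ∷ʳ i) ∨ ((j <ᵇ i) ∧ any (i <ᵇ_) W) ≡⟨ contains3-21-∷ʳ-∷ʳ W i j ⟨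
        contains3-21 (W ++ i ∷ j ∷ [])                      ≡⟨ cong contains3-21 concat-C ⟨
        contains3-21 (concat (D ∷ʳ (ℓ ∷ t) ∷ʳ (i ∷ j ∷ []))) ≡⟨ proj₂ inD-C ⟩
        false                                               ∎))
        where open ≡-Reasoning

      3≤|d′| : 3 ≤ length (ℓ ∷ map (punchOut j) t ∷ʳ i)
      3≤|d′| = s≤s (subst (2 ≤_) (sym (trans (length-∷ʳ (map (punchOut j) t) i) (cong suc (length-map (punchOut j) t))))
                          (s≤s 1≤|t|))

      ℓ∈range : ℓ ∈ range 1 i
      ℓ∈range = ∈-range⁺
        (proj₁ (∈[1‥]⁻ (sound C-form (subst (ℓ ∈_) (sym concat-C) (∈-++⁺ˡ (∈-++⁺ʳ (concat D) (here refl)))))))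
                         (proj₂ standard-split)

    image : shortImage i (relabel (punchOut j) (D ∷ʳ d′)) ≡ true
    image rewrite lastCycle-C′ = cong₂ _∧_ inD-C′
      (cong₂ _∧_ (cong₂ _∧_ (any-true⁺ (λ ℓ′ → firstIs ℓ′ (ℓ ∷ map (punchOut j) t ∷ʳ i)) ℓ∈range (≡ᵇ-refl ℓ))
                            (lastIs-refl i (ℓ ∷ map (punchOut j) t)))
                 (≤⇒≤ᵇ-true 3≤|d′|))
      where
      inD-C′ : inD3-21Form (relabel (punchOut j) (D ∷ʳ d′)) ≡ true
      inD-C′ = trans (inD3-21Form-relabel (punchOut j) (D ∷ʳ d′) λ x∈ y∈ → punchOut-mono-< j (≢j x∈) (≢j y∈))
        (inD3-21Form-∷ʳ⁺ D d′ (proj₁ (derangedCycles-∷ʳ⁻ D (ℓ ∷ t) (proj₁ (proj₁ inD-C))))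
                      (s≤s (subst (1 ≤_) (sym (length-∷ʳ t i)) (s≤s z≤n)))
                      (trans (cong contains3-21 concat-C′) avoids-prefix))

    inverse : splitLastTwo j (relabel (punchOut j) (D ∷ʳ d′)) ≡ D ∷ʳ (ℓ ∷ t) ∷ʳ (i ∷ j ∷ [])
    inverse = trans (cong (splitLast j) (trans (relabel-∘ (punchIn j) (punchOut j) (D ∷ʳ d′))
                                               (relabel-id-local _ (D ∷ʳ d′) (punchIn-punchOut ∘ ≢j))))
                    (splitLast-∷ʳ j D (ℓ ∷ t) i)

  forth : ∀ {C} → 2 ≤ m → IsCycleForm (suc m) C → shortForm i j C ≡ true →
    (IsCycleForm m (mergeLastTwo j C) × shortImage i (mergeLastTwo j C) ≡ true) ×
    (splitLastTwo j (mergeLastTwo j C) ≡ C × length C ≡ suc (length (mergeLastTwo j C)))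
  forth {C} 2≤m C-form shortForm≡ with D , ℓ , t , 1≤|t| , refl ← shortForm-shape C 2≤m C-form shortForm≡
    rewrite mergeLastTwo-∷ʳ D (ℓ ∷ t) =
    (C′-form , image) , (inverse , trans (length-∷ʳ (D ∷ʳ (ℓ ∷ t)) (i ∷ j ∷ []))
                                         (cong suc (trans (length-∷ʳ D (ℓ ∷ t))
                                                          (sym (trans (length-map _ (D ∷ʳ d′)) (length-∷ʳ D d′))))))
    where open Forth D ℓ t 1≤|t| C-form (proj₁ (∧-true⁻ {inD3-21Form C} shortForm≡))

  shortImage-shape : ∀ E → shortImage i E ≡ true →
                     ∃₂ λ D ℓ → ∃ λ t → ℓ ∈ range 1 i × 1 ≤ length t × E ≡ D ∷ʳ (ℓ ∷ t ∷ʳ i)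
  shortImage-shape E image≡ with initLast E
  ... | [] = ⊥-elim (false≢true (trans (sym (∧-zeroʳ (any (λ _ → false) (range 1 i) ∧ false))) image≡))
  ... | D ∷ʳ′ c
    with (ends , long) ← ∧-true⁻ {any (λ ℓ → firstIs ℓ c) (range 1 i) ∧ lastIs i c}
           (subst (λ L → (any (λ ℓ → firstIs ℓ L) (range 1 i) ∧ lastIs i L) ∧ (3 ≤ᵇ length L) ≡ true) (lastOf-∷ʳ D c)
                  (proj₂ (∧-true⁻ {inD3-21Form (D ∷ʳ c)} image≡)))
    with (first , last) ← ∧-true⁻ {any (λ ℓ → firstIs ℓ c) (range 1 i)} ends
    with ℓ , ℓ∈ , firstℓ ← any-true⁻ (λ ℓ → firstIs ℓ c) (range 1 i) first
    with u , refl ← firstIs-lastIs⁻ {ℓ} {i} {c} firstℓ last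
                      (≤-trans (s≤s (s≤s z≤n)) (≤ᵇ⇒≤ 3 (length c) (Equivalence.from T-≡ long)))
    with u
  ... | []    with () ← long
  ... | x ∷ w = D , ℓ , x ∷ w , ℓ∈ , s≤s z≤n , refl

  module Back (D : Cycles) (ℓ : ℕ) (t : List ℕ) (ℓ∈ : ℓ ∈ range 1 i) (1≤|t| : 1 ≤ length t)
              (E-form : IsCycleForm m (D ∷ʳ (ℓ ∷ t ∷ʳ i)))
              (image≡ : shortImage i (D ∷ʳ (ℓ ∷ t ∷ʳ i)) ≡ true) where

    D⁺ : Cycles
    D⁺ = relabel (punchIn j) D

    t⁺ : List ℕ
    t⁺ = map (punchIn j) t

    X : Cycles
    X = D⁺ ∷ʳ (ℓ ∷ t⁺) ∷ʳ (i ∷ j ∷ [])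

    private
      ℓ<i : ℓ < i
      ℓ<i = proj₂ (∈-range⁻ ℓ∈)

    relabel-E : relabel (punchIn j) (D ∷ʳ (ℓ ∷ t ∷ʳ i)) ≡ D⁺ ∷ʳ (ℓ ∷ t⁺ ∷ʳ i)
    relabel-E = trans (relabel-∷ʳ (punchIn j) D (ℓ ∷ t ∷ʳ i))
      (cong (D⁺ ∷ʳ_) (cong₂ _∷_ (punchIn-< (<-trans ℓ<i i<j))
                                (trans (map-++ (punchIn j) t [ i ]) (cong (t⁺ ∷ʳ_) (punchIn-< i<j)))))

    splitLastTwo≡X : splitLastTwo j (D ∷ʳ (ℓ ∷ t ∷ʳ i)) ≡ X
    splitLastTwo≡X = trans (cong (splitLast j) relabel-E) (splitLast-∷ʳ j D⁺ (ℓ ∷ t⁺) i)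

    V : List ℕ
    V = concat D⁺ ++ ℓ ∷ t⁺

    concat-E⁺ : map (punchIn j) (concat (D ∷ʳ (ℓ ∷ t ∷ʳ i))) ≡ V ∷ʳ i
    concat-E⁺ = begin
      map (punchIn j) (concat (D ∷ʳ (ℓ ∷ t ∷ʳ i)))  ≡⟨ concat-relabel (punchIn j) (D ∷ʳ (ℓ ∷ t ∷ʳ i)) ⟨
      concat (relabel (punchIn j) (D ∷ʳ (ℓ ∷ t ∷ʳ i))) ≡⟨ cong concat relabel-E ⟩
      concat (D⁺ ∷ʳ (ℓ ∷ t⁺ ∷ʳ i))                  ≡⟨ concat-∷ʳ D⁺ (ℓ ∷ t⁺ ∷ʳ i) ⟩
      concat D⁺ ++ ℓ ∷ t⁺ ∷ʳ i                      ≡⟨ ++-assoc (concat D⁺) (ℓ ∷ t⁺) [ i ] ⟨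
      V ∷ʳ i                                        ∎
      where open ≡-Reasoning

    concat-X : concat X ≡ V ++ i ∷ j ∷ []
    concat-X =
      trans (concat-∷ʳ (D⁺ ∷ʳ (ℓ ∷ t⁺)) (i ∷ j ∷ [])) (cong (_++ i ∷ j ∷ []) (concat-∷ʳ D⁺ (ℓ ∷ t⁺)))

    X-form : IsCycleForm (suc m) X
    X-form = IsCycleForm-punchIn 1≤j j≤1+m E-form X-std
      (trans concat-X (trans (sym (++-assoc V [ i ] [ j ])) (cong (_∷ʳ j) (sym concat-E⁺))))
      where
      E⁺-std : Standard (D⁺ ∷ʳ (ℓ ∷ t⁺ ∷ʳ i))
      E⁺-std = subst Standard relabel-E (Standard-relabel (punchIn j) _ (λ _ _ → punchIn-mono-< j) (standard E-form))
      X-std : Standard X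
      X-std = Standard-∷ʳ-cycle D⁺ (Standard-replaceLast D⁺ E⁺-std (All.++⁻ˡ t⁺ (Standard-last D⁺ E⁺-std)))
                                   ℓ<i (i<j ∷ [])

    shortForm-X : shortForm i j X ≡ true
    shortForm-X rewrite lastOf-∷ʳ (D⁺ ∷ʳ (ℓ ∷ t⁺)) (i ∷ j ∷ []) | ≡ᵇ-refl i | ≡ᵇ-refl j =
      trans (∧-identityʳ _) inD-X
      where
      E : Cycles
      E = D ∷ʳ (ℓ ∷ t ∷ʳ i)
      inD-E : (derangedCycles D ≡ true × 2 ≤ length (ℓ ∷ t ∷ʳ i)) × contains3-21 (concat E) ≡ false
      inD-E = inD3-21Form-∷ʳ⁻ D (ℓ ∷ t ∷ʳ i) (proj₁ (∧-true⁻ {inD3-21Form E} image≡))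
      avoids-prefix : contains3-21 (V ∷ʳ i) ≡ false
      avoids-prefix = begin
        contains3-21 (V ∷ʳ i)                         ≡⟨ cong contains3-21 concat-E⁺ ⟨
        contains3-21 (map (punchIn j) (concat E))     ≡⟨ contains3-21-map (punchIn j) (concat E) (λ _ _ → punchIn-mono-< j) ⟩
        contains3-21 (concat E)                       ≡⟨ proj₂ inD-E ⟩
        false                                         ∎
        where open ≡-Reasoning
      inD-X : inD3-21Form X ≡ true
      inD-X = inD3-21Form-∷ʳ⁺ (D⁺ ∷ʳ (ℓ ∷ t⁺)) (i ∷ j ∷ [])
        (derangedCycles-∷ʳ⁺ D⁺ (ℓ ∷ t⁺) (trans (derangedCycles-relabel (punchIn j) D) (proj₁ (proj₁ inD-E)))
                                       (s≤s (subst (1 ≤_) (sym (length-map (punchIn j) t)) 1≤|t|)))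
        ≤-refl
        (trans (cong contains3-21 concat-X)
          (trans (contains3-21-∷ʳ-∷ʳ V i j) (cong₂ _∨_ avoids-prefix (cong (_∧ any (i <ᵇ_) V) (≮⇒<ᵇ-false (<⇒≯ i<j))))))

    inverse : mergeLastTwo j X ≡ D ∷ʳ (ℓ ∷ t ∷ʳ i)
    inverse = begin
      mergeLastTwo j X                                   ≡⟨ mergeLastTwo-∷ʳ D⁺ (ℓ ∷ t⁺) ⟩
      relabel (punchOut j) (D⁺ ∷ʳ (ℓ ∷ t⁺ ∷ʳ i))         ≡⟨ cong (relabel (punchOut j)) relabel-E ⟨
      relabel (punchOut j) (relabel (punchIn j) (D ∷ʳ (ℓ ∷ t ∷ʳ i))) ≡⟨ relabel-∘ (punchOut j) (punchIn j) _ ⟩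
      relabel (punchOut j ∘ punchIn j) (D ∷ʳ (ℓ ∷ t ∷ʳ i))            ≡⟨ relabel-id-local _ _ (λ {x} _ → punchOut-punchIn j x) ⟩
      D ∷ʳ (ℓ ∷ t ∷ʳ i)                                  ∎
      where open ≡-Reasoning

  back : ∀ {E} → IsCycleForm m E → shortImage i E ≡ true →
    (IsCycleForm (suc m) (splitLastTwo j E) × shortForm i j (splitLastTwo j E) ≡ true) ×
    mergeLastTwo j (splitLastTwo j E) ≡ E
  back {E} E-form image≡ with D , ℓ , t , ℓ∈ , 1≤|t| , refl ← shortImage-shape E image≡
    rewrite Back.splitLastTwo≡X D ℓ t ℓ∈ 1≤|t| E-form image≡ =
    (X-form , shortForm-X) , inverse
    where open Back D ℓ t ℓ∈ 1≤|t| E-form image≡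

weight-rForm : ∀ i j y C → weight (rForm i j) y C ≡ weight (sForm i j) y C + weight (shortForm i j) y C
weight-rForm i j y C = split (inD3-21Form C) (firstIs i (lastOf C) ∧ lastIs j (lastOf C)) (3 ≤ᵇ length (lastOf C))
  where
  split : ∀ a b l → (if a ∧ b then y ^ length C else 0)
                  ≡ (if a ∧ (b ∧ l) then y ^ length C else 0) + (if a ∧ (b ∧ not l) then y ^ length C else 0)
  split false _     _     = refl
  split true  false _     = refl
  split true  true  true  = sym (+-identityʳ _)
  split true  true  false = refl

weight-longImage : ∀ m i j y C → weight (longImage m i j) y C
  ≡ ind< j (suc m) * weight (rForm i m) y C + sum (map (λ k → weight (rForm i k) y C) (range (i + 1) j))
weight-longImage m i j y C = begin
  weight (longImage m i j) y C
    ≡⟨ split a F below (j <ᵇ suc m) (lastIs m L) exclusive ⟩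
  ind< j (suc m) * weight (rForm i m) y C + (if a ∧ (F ∧ below) then Y else 0)
    ≡⟨ cong (λ b → ind< j (suc m) * weight (rForm i m) y C + (if b then Y else 0)) any-rForm ⟨
  ind< j (suc m) * weight (rForm i m) y C + (if any (λ k → rForm i k C) (range (i + 1) j) then Y else 0)
    ≡⟨ cong (ind< j (suc m) * weight (rForm i m) y C +_)
            (sum-if-at-most-one (λ k → rForm i k C) Y (Unique-range (i + 1) j) same-last) ⟨
  ind< j (suc m) * weight (rForm i m) y C + sum (map (λ k → weight (rForm i k) y C) (range (i + 1) j)) ∎
  where
  open ≡-Reasoning
  L : List ℕ
  L = lastOf C
  Y : ℕ
  Y = y ^ length C
  a F below : Bool
  a = inD3-21Form C
  F = firstIs i L
  below = any (λ k → lastIs k L) (range (i + 1) j)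
  any-rForm : any (λ k → rForm i k C) (range (i + 1) j) ≡ a ∧ (F ∧ below)
  any-rForm = trans (any-∧ˡ a (λ k → F ∧ lastIs k L) (range (i + 1) j))
                    (cong (a ∧_) (any-∧ˡ F (λ k → lastIs k L) (range (i + 1) j)))
  last-of : ∀ {k} → rForm i k C ≡ true → lastIs k L ≡ true
  last-of k≡ = proj₂ (∧-true⁻ {F} (proj₂ (∧-true⁻ {a} k≡)))
  same-last : ∀ {k k′} → k ∈ range (i + 1) j → k′ ∈ range (i + 1) j → rForm i k C ≡ true → rForm i k′ C ≡ true → k ≡ k′
  same-last _ _ k≡ k′≡ = lastIs-unique L (last-of k≡) (last-of k′≡)
  exclusive : (j <ᵇ suc m) ≡ true → lastIs m L ≡ true → below ≡ false
  exclusive j≤m last-m = any-false⁺ _ (range (i + 1) j) λ {k} k∈ → not-last k∈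
    where
    not-last : ∀ {k} → k ∈ range (i + 1) j → lastIs k L ≡ false
    not-last {k} k∈ with lastIs k L in last-k
    ... | false = refl
    ... | true with refl ← lastIs-unique L last-k last-m =
      ⊥-elim (<⇒≱ (proj₂ (∈-range⁻ k∈)) (≤-pred (<ᵇ-true⇒< j≤m)))
  split : ∀ a F X J Lm → (J ≡ true → Lm ≡ true → X ≡ false) →
          (if a ∧ (F ∧ (X ∨ (J ∧ Lm))) then Y else 0)
          ≡ (if J then 1 else 0) * (if a ∧ (F ∧ Lm) then Y else 0) + (if a ∧ (F ∧ X) then Y else 0)
  split false _     _     J     _     _  = sym (cong (_+ 0) (*-zeroʳ (if J then 1 else 0)))
  split true  false _     J     _     _  = sym (cong (_+ 0) (*-zeroʳ (if J then 1 else 0)))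
  split true  true  true  false _     _  = refl
  split true  true  true  true  false _  = refl
  split true  true  true  true  true  ex with () ← ex refl refl
  split true  true  false false _     _  = refl
  split true  true  false true  true  _  = trans (sym (+-identityʳ Y)) (cong (_+ 0) (sym (+-identityʳ Y)))
  split true  true  false true  false _  = refl

weight-shortImage : ∀ i y C → (if shortImage i C then y * y ^ length C else 0)
                              ≡ y * sum (map (λ ℓ → weight (sForm ℓ i) y C) (range 1 i))
weight-shortImage i y C = begin
  (if shortImage i C then y * Y else 0)
    ≡⟨ cong (if shortImage i C then y * Y else_) (*-zeroʳ y) ⟨
  (if shortImage i C then y * Y else y * 0)
    ≡⟨ if-float (y *_) (shortImage i C) ⟨
  y * (if shortImage i C then Y else 0)
    ≡⟨ cong (λ b → y * (if b then Y else 0)) any-sForm ⟨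
  y * (if any (λ ℓ → sForm ℓ i C) (range 1 i) then Y else 0)
    ≡⟨ cong (y *_) (sum-if-at-most-one (λ ℓ → sForm ℓ i C) Y (Unique-range 1 i) same-first) ⟨
  y * sum (map (λ ℓ → weight (sForm ℓ i) y C) (range 1 i))  ∎
  where
  open ≡-Reasoning
  L : List ℕ
  L = lastOf C
  Y : ℕ
  Y = y ^ length C
  a B long : Bool
  a = inD3-21Form C
  B = lastIs i L
  long = 3 ≤ᵇ length L
  any-sForm : any (λ ℓ → sForm ℓ i C) (range 1 i) ≡ shortImage i C
  any-sForm = trans (any-∧ˡ a (λ ℓ → (firstIs ℓ L ∧ B) ∧ long) (range 1 i))
    (cong (a ∧_) (trans (any-∧ʳ (λ ℓ → firstIs ℓ L ∧ B) long (range 1 i))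
                        (cong (_∧ long) (any-∧ʳ (λ ℓ → firstIs ℓ L) B (range 1 i)))))
  first-of : ∀ {ℓ} → sForm ℓ i C ≡ true → firstIs ℓ L ≡ true
  first-of {ℓ} ℓ≡ = proj₁ (∧-true⁻ {firstIs ℓ L} (proj₁ (∧-true⁻ {firstIs ℓ L ∧ B} (proj₂ (∧-true⁻ {a} ℓ≡)))))
  same-first : ∀ {ℓ ℓ′} → ℓ ∈ range 1 i → ℓ′ ∈ range 1 i → sForm ℓ i C ≡ true → sForm ℓ′ i C ≡ true → ℓ ≡ ℓ′
  same-first _ _ ℓ≡ ℓ′≡ = firstIs-unique L (first-of ℓ≡) (first-of ℓ′≡)

module _ {m i j : ℕ} (1≤i : 1 ≤ i) (i<j : i < j) (j≤1+m : j ≤ suc m) (y : ℕ) where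

  sum-sForm : sum (map (weight (sForm i j) y) (cycleForms (suc m)))
            ≡ sum (map (weight (longImage m i j) y) (cycleForms m))
  sum-sForm = sum-if-bijection (Unique-cycleForms (suc m)) (Unique-cycleForms m) (sForm i j) (longImage m i j)
    (λ C → y ^ length C) (λ C → y ^ length C) (dropLastEntry j) (appendLastEntry j) forth back
    where
    forth : ∀ {C} → C ∈ cycleForms (suc m) → sForm i j C ≡ true →
      (dropLastEntry j C ∈ cycleForms m × longImage m i j (dropLastEntry j C) ≡ true) ×
      (appendLastEntry j (dropLastEntry j C) ≡ C × y ^ length (dropLastEntry j C) ≡ y ^ length C)
    forth C∈ sForm≡
      with (form , image) , (inverse , same-length)
             ← LongCase.forth 1≤i i<j j≤1+m (∈cycleForms⇒IsCycleForm (suc m) C∈) sForm≡ =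
      (IsCycleForm⇒∈cycleForms form , image) , (inverse , cong (y ^_) same-length)
    back : ∀ {E} → E ∈ cycleForms m → longImage m i j E ≡ true →
      (appendLastEntry j E ∈ cycleForms (suc m) × sForm i j (appendLastEntry j E) ≡ true) ×
      dropLastEntry j (appendLastEntry j E) ≡ E
    back E∈ image≡
      with (form , sForm≡) , inverse ← LongCase.back 1≤i i<j j≤1+m (∈cycleForms⇒IsCycleForm m E∈) image≡ =
      (IsCycleForm⇒∈cycleForms form , sForm≡) , inverse

  sum-shortForm : 2 ≤ m → sum (map (weight (shortForm i j) y) (cycleForms (suc m)))
                        ≡ sum (map (λ C → if shortImage i C then y * y ^ length C else 0) (cycleForms m))
  sum-shortForm 2≤m = sum-if-bijection (Unique-cycleForms (suc m)) (Unique-cycleForms m) (shortForm i j) (shortImage i)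
    (λ C → y ^ length C) (λ C → y * y ^ length C) (mergeLastTwo j) (splitLastTwo j) forth back
    where
    forth : ∀ {C} → C ∈ cycleForms (suc m) → shortForm i j C ≡ true →
      (mergeLastTwo j C ∈ cycleForms m × shortImage i (mergeLastTwo j C) ≡ true) ×
      (splitLastTwo j (mergeLastTwo j C) ≡ C × y * y ^ length (mergeLastTwo j C) ≡ y ^ length C)
    forth C∈ shortForm≡
      with (form , image) , (inverse , one-more)
             ← ShortCase.forth 1≤i i<j j≤1+m 2≤m (∈cycleForms⇒IsCycleForm (suc m) C∈) shortForm≡ =
      (IsCycleForm⇒∈cycleForms form , image) , (inverse , cong (y ^_) (sym one-more))
    back : ∀ {E} → E ∈ cycleForms m → shortImage i E ≡ true →
      (splitLastTwo j E ∈ cycleForms (suc m) × shortForm i j (splitLastTwo j E) ≡ true) ×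
      mergeLastTwo j (splitLastTwo j E) ≡ E
    back E∈ image≡
      with (form , shortForm≡) , inverse ← ShortCase.back 1≤i i<j j≤1+m (∈cycleForms⇒IsCycleForm m E∈) image≡ =
      (IsCycleForm⇒∈cycleForms form , shortForm≡) , inverse

  s-recurrence : s (suc m) i j y ≡ ind< j (suc m) * r m i m y + sum (map (λ k → r m i k y) (range (i + 1) j))
  s-recurrence = begin
    s (suc m) i j y
      ≡⟨ s≡sum-cycleForms (suc m) i j y ⟩
    sum (map (weight (sForm i j) y) (cycleForms (suc m)))
      ≡⟨ sum-sForm ⟩
    sum (map (weight (longImage m i j) y) (cycleForms m))
      ≡⟨ cong sum (map-cong (weight-longImage m i j y) (cycleForms m)) ⟩
    sum (map (λ C → ind< j (suc m) * weight (rForm i m) y C + sum (map (λ k → weight (rForm i k) y C) (range (i + 1) j)))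
             (cycleForms m))
      ≡⟨ sum-map-+ _ _ (cycleForms m) ⟩
    sum (map (λ C → ind< j (suc m) * weight (rForm i m) y C) (cycleForms m))
      + sum (map (λ C → sum (map (λ k → weight (rForm i k) y C) (range (i + 1) j))) (cycleForms m))
      ≡⟨ cong₂ _+_ (sum-map-* (ind< j (suc m)) (weight (rForm i m) y) (cycleForms m))
                   (sum-map-swap (λ C k → weight (rForm i k) y C) (cycleForms m) (range (i + 1) j)) ⟩
    ind< j (suc m) * sum (map (weight (rForm i m) y) (cycleForms m))
      + sum (map (λ k → sum (map (weight (rForm i k) y) (cycleForms m))) (range (i + 1) j))
      ≡⟨ cong₂ _+_ (cong (ind< j (suc m) *_) (r≡sum-cycleForms m i m y))
                   (cong sum (map-cong (λ k → r≡sum-cycleForms m i k y) (range (i + 1) j))) ⟨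
    ind< j (suc m) * r m i m y + sum (map (λ k → r m i k y) (range (i + 1) j))  ∎
    where open ≡-Reasoning

  r-recurrence : 2 ≤ m → r (suc m) i j y ≡ s (suc m) i j y + y * sum (map (λ ℓ → s m ℓ i y) (range 1 i))
  r-recurrence 2≤m = begin
    r (suc m) i j y
      ≡⟨ r≡sum-cycleForms (suc m) i j y ⟩
    sum (map (weight (rForm i j) y) (cycleForms (suc m)))
      ≡⟨ cong sum (map-cong (weight-rForm i j y) (cycleForms (suc m))) ⟩
    sum (map (λ C → weight (sForm i j) y C + weight (shortForm i j) y C) (cycleForms (suc m)))
      ≡⟨ sum-map-+ _ _ (cycleForms (suc m)) ⟩
    sum (map (weight (sForm i j) y) (cycleForms (suc m))) + sum (map (weight (shortForm i j) y) (cycleForms (suc m)))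
      ≡⟨ cong₂ _+_ (sym (s≡sum-cycleForms (suc m) i j y)) (sum-shortForm 2≤m) ⟩
    s (suc m) i j y + sum (map (λ C → if shortImage i C then y * y ^ length C else 0) (cycleForms m))
      ≡⟨ cong (s (suc m) i j y +_) short-part ⟩
    s (suc m) i j y + y * sum (map (λ ℓ → s m ℓ i y) (range 1 i))  ∎
    where
    open ≡-Reasoning
    short-part : sum (map (λ C → if shortImage i C then y * y ^ length C else 0) (cycleForms m))
               ≡ y * sum (map (λ ℓ → s m ℓ i y) (range 1 i))
    short-part = begin
      sum (map (λ C → if shortImage i C then y * y ^ length C else 0) (cycleForms m))
        ≡⟨ cong sum (map-cong (weight-shortImage i y) (cycleForms m)) ⟩
      sum (map (λ C → y * sum (map (λ ℓ → weight (sForm ℓ i) y C) (range 1 i))) (cycleForms m))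
        ≡⟨ sum-map-* y _ (cycleForms m) ⟩
      y * sum (map (λ C → sum (map (λ ℓ → weight (sForm ℓ i) y C) (range 1 i))) (cycleForms m))
        ≡⟨ cong (y *_) (sum-map-swap (λ C ℓ → weight (sForm ℓ i) y C) (cycleForms m) (range 1 i)) ⟩
      y * sum (map (λ ℓ → sum (map (weight (sForm ℓ i) y) (cycleForms m))) (range 1 i))
        ≡⟨ cong (y *_) (cong sum (map-cong (λ ℓ → s≡sum-cycleForms m ℓ i y) (range 1 i))) ⟨
      y * sum (map (λ ℓ → s m ℓ i y) (range 1 i))  ∎

lemma3p4 : ((y : ℕ) → r 2 1 2 y ≡ y × s 2 1 2 y ≡ 0)
    × ((y n i j : ℕ) → 3 ≤ n → 1 ≤ i → i < j → j ≤ n →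
        (r n i j y ≡ ind< j n * r (n ∸ 1) i (n ∸ 1) y
                     + sum (map (λ k → r (n ∸ 1) i k y) (range (i + 1) j))
                     + y * sum (map (λ ℓ → s (n ∸ 1) ℓ i y) (range 1 i)))
      × (s n i j y + y * sum (map (λ ℓ → s (n ∸ 1) ℓ i y) (range 1 i)) ≡ r n i j y))
-- For n = 2 both sums are evaluated: the only derangement of [2] is (1 2).
lemma3p4 = (λ y → trans (+-identityʳ (y * 1)) (*-identityʳ y) , refl)
         , λ { y (suc m) i j (s≤s 2≤m) 1≤i i<j j≤1+m →
               trans (r-recurrence 1≤i i<j j≤1+m y 2≤m)
                     (cong (_+ y * sum (map (λ ℓ → s m ℓ i y) (range 1 i))) (s-recurrence 1≤i i<j j≤1+m y))
             , sym (r-recurrence 1≤i i<j j≤1+m y 2≤m) }
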